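{- The following eight mesh patterns $(12,R)$ are pairwise equidistributed, where $R$ ranges over: $\{(0,2),(1,2),(2,2),(2,1),(0,0),(1,0)\}$, $\{(0,2),(2,2),(0,1),(2,1),(0,0),(1,0)\}$, $\{(1,2),(2,2),(0,1),(2,1),(0,0),(2,0)\}$, $\{(1,2),(2,2),(0,1),(0,0),(1,0),(2,0)\}$, $\{(0,2),(1,2),(2,2),(0,1),(1,1),(2,0)\}$, $\{(0,2),(1,2),(0,1),(1,1),(0,0),(2,0)\}$, $\{(0,2),(2,2),(1,1),(2,1),(1,0),(2,0)\}$, $\{(0,2),(1,1),(2,1),(0,0),(1,0),(2,0)\}$. Moreover, for each such pattern $p$ and $n\ge1$, $$\sum_{\pi\in S_n}q^{p(\pi)}=n!-\sum_{i=0}^{n-2}i!(n-i-1)!+q\sum_{i=0}^{n-2}i!(n-i-1)!.$$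
   Context: For $R\subseteq\{0,1,2\}^2$ and $\pi=\pi_1\cdots\pi_n\in S_n$, an occurrence of the mesh pattern $(12,R)$ in $\pi$ is a pair of positions $i_1<i_2$ with $\pi_{i_1}<\pi_{i_2}$ such that, setting $x_0=0,x_1=i_1,x_2=i_2,x_3=n+1$ and $y_0=0,y_1=\pi_{i_1},y_2=\pi_{i_2},y_3=n+1$, for every $(a,b)\in R$ there is no index $k$ with $x_a<k<x_{a+1}$ and $y_b<\pi_k<y_{b+1}$. $p(\pi)$ is the number of occurrences of $p$ in $\pi$; $s_{n,k}(p)$ the number of $\pi\in S_n$ with $p(\pi)=k$; $p_1,p_2$ are equidistributed if $s_{n,k}(p_1)=s_{n,k}(p_2)$ for all $n,k\ge 0$. -}

module Defs where

open import Data.Nat using (ℕ; zero; suc; _+_; _*_; _∸_; _<ᵇ_; _≡ᵇ_)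
open import Data.Nat using (_!)
open import Data.Nat.ListAction using (sum)
open import Data.Bool.ListAction using (all)
open import Data.Bool using (Bool; true; false; _∧_; _∨_; not; if_then_else_)
open import Data.Fin using (Fin; toℕ; zero; suc)
import Data.Fin as F
open import Data.Vec using (Vec; []; _∷_; lookup)
open import Data.List using (List; []; _∷_; [_]; map; concatMap; length; filterᵇ; allFin; upTo)
open import Data.Product using (_×_; _,_)
open import Relation.Nullary.Decidable using (⌊_⌋)

-- A permutation π ∈ S_n is represented as a word π = π₁⋯πₙ, i.e. a vector
-- of length n with entries in Fin n (entry v stands for the value toℕ v + 1),
-- whose entries are pairwise distinct.
Word : ℕ → Set
Word n = Vec (Fin n) n

allVecs : (m l : ℕ) → List (Vec (Fin m) l)
allVecs m zero = [ [] ]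
allVecs m (suc l) = concatMap (λ v → map (_∷ v) (allFin m)) (allVecs m l)

isInjective : ∀ {n} → Word n → Bool
isInjective {n} π =
  all (λ i → all (λ j → not ⌊ lookup π i F.≟ lookup π j ⌋ ∨ ⌊ i F.≟ j ⌋) (allFin n)) (allFin n)

S : (n : ℕ) → List (Word n)
S n = filterᵇ isInjective (allVecs n n)

-- mesh patterns (12, R), R ⊆ {0,1,2}²
MeshR : Set
MeshR = List (Fin 3 × Fin 3)

-- position (1-based) and value (1-based)
pos : ∀ {n} → Fin n → ℕ
pos i = suc (toℕ i)

val : ∀ {n} → Word n → Fin n → ℕ
val π i = suc (toℕ (lookup π i))

bnd : ℕ → ℕ → ℕ → ℕ → Fin 4 → ℕ
bnd c0 c1 c2 c3 zero = c0
bnd c0 c1 c2 c3 (suc zero) = c1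
bnd c0 c1 c2 c3 (suc (suc zero)) = c2
bnd c0 c1 c2 c3 (suc (suc (suc zero))) = c3

isOcc : ∀ {n} → MeshR → Word n → Fin n → Fin n → Bool
isOcc {n} R π i₁ i₂ =
  (pos i₁ <ᵇ pos i₂) ∧ (val π i₁ <ᵇ val π i₂) ∧
  all (λ { (a , b) → all (λ k → not (
         (x (F.inject₁ a) <ᵇ pos k) ∧ (pos k <ᵇ x (suc a)) ∧
         (y (F.inject₁ b) <ᵇ val π k) ∧ (val π k <ᵇ y (suc b)))) (allFin n) }) R
  where
    x y : Fin 4 → ℕ
    x = bnd 0 (pos i₁) (pos i₂) (suc n)
    y = bnd 0 (val π i₁) (val π i₂) (suc n)

occ : ∀ {n} → MeshR → Word n → ℕ
occ {n} R π = length (filterᵇ (λ { (i₁ , i₂) → isOcc R π i₁ i₂ })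
                       (concatMap (λ i → map (i ,_) (allFin n)) (allFin n)))

s : ℕ → ℕ → MeshR → ℕ
s n k R = length (filterᵇ (λ π → occ R π ≡ᵇ k) (S n))

A : ℕ → ℕ
A n = sum (map (λ i → (i !) * ((n ∸ i ∸ 1) !)) (upTo (n ∸ 1)))

pat : Fin 8 → MeshR
pat zero = (# 0 , # 2) ∷ (# 1 , # 2) ∷ (# 2 , # 2) ∷ (# 2 , # 1) ∷ (# 0 , # 0) ∷ (# 1 , # 0) ∷ []
  where open import Data.Fin using (#_)
pat (suc zero) = (# 0 , # 2) ∷ (# 2 , # 2) ∷ (# 0 , # 1) ∷ (# 2 , # 1) ∷ (# 0 , # 0) ∷ (# 1 , # 0) ∷ []
  where open import Data.Fin using (#_)
pat (suc (suc zero)) = (# 1 , # 2) ∷ (# 2 , # 2) ∷ (# 0 , # 1) ∷ (# 2 , # 1) ∷ (# 0 , # 0) ∷ (# 2 , # 0) ∷ []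
  where open import Data.Fin using (#_)
pat (suc (suc (suc zero))) = (# 1 , # 2) ∷ (# 2 , # 2) ∷ (# 0 , # 1) ∷ (# 0 , # 0) ∷ (# 1 , # 0) ∷ (# 2 , # 0) ∷ []
  where open import Data.Fin using (#_)
pat (suc (suc (suc (suc zero)))) = (# 0 , # 2) ∷ (# 1 , # 2) ∷ (# 2 , # 2) ∷ (# 0 , # 1) ∷ (# 1 , # 1) ∷ (# 2 , # 0) ∷ []
  where open import Data.Fin using (#_)
pat (suc (suc (suc (suc (suc zero))))) = (# 0 , # 2) ∷ (# 1 , # 2) ∷ (# 0 , # 1) ∷ (# 1 , # 1) ∷ (# 0 , # 0) ∷ (# 2 , # 0) ∷ []
  where open import Data.Fin using (#_)
pat (suc (suc (suc (suc (suc (suc zero)))))) = (# 0 , # 2) ∷ (# 2 , # 2) ∷ (# 1 , # 1) ∷ (# 2 , # 1) ∷ (# 1 , # 0) ∷ (# 2 , # 0) ∷ []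
  where open import Data.Fin using (#_)
pat (suc (suc (suc (suc (suc (suc (suc zero))))))) = (# 0 , # 2) ∷ (# 1 , # 1) ∷ (# 2 , # 1) ∷ (# 0 , # 0) ∷ (# 1 , # 0) ∷ (# 2 , # 0) ∷ []
  where open import Data.Fin using (#_)

{-# OPTIONS --safe #-}
module Submission where

-- For each of the eight patterns p = (12, R) the unshaded cells form blocks: the three column
-- strips and the three row strips are sent to three blocks so that a cell is unshaded exactly
-- when its column and its row go to the same block.  Given an occurrence at positions u₁ < u₂
-- (counted from 0) with values a < b, every other point of π must send the positions of a block
-- to values of the same block, and counting such injections gives ∏ (block size)! if every block
-- has as many positions as values ("balanced") and 0 otherwise.  For patterns 0 and 4 a balanced
-- configuration forces b to be the largest value and determines a from u₂, so every π contains p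
-- at most once and the number of occurrences over S_n is
-- ∑ u₂ · (u₂ - 1)! (n - 1 - u₂)! = ∑ i! (n - 1 - i)!.  The other six patterns are images of these
-- two under transposition (inverse permutation) and rotation by 180° (reverse-complement), which
-- preserve both the number of balanced configurations and their rigidity.

open import Defs
open import Data.Nat using (ℕ; _≤_; _∸_)
open import Data.Nat using (_!)
open import Data.Fin using (Fin)
open import Data.Product using (_×_)
open import Relation.Binary.PropositionalEquality using (_≡_)

open import Data.Bool.Base using (Bool; true; false; _∧_; _∨_; _xor_; not; T)
open import Data.Bool.ListAction using (all)
open import Data.Bool.Properties using (T-∧; T-∨; T-≡; T?; ∧-comm; ∧-assoc; ∧-zeroʳ; ∧-identityʳ)
open import Data.Empty using (⊥-elim)
open import Data.Fin using (#_)
open import Data.Fin.Base using (toℕ; opposite) renaming (zero to fzero; suc to fsuc)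
open import Data.Fin.Properties using (toℕ-injective; toℕ<n) renaming (suc-injective to fsuc-injective)
import Data.Fin.Base as F
import Data.Fin.Properties as F
open import Data.List.Base using (List; []; _∷_; map; concatMap; length; filterᵇ; allFin; _++_; applyUpTo; cartesianProduct)
open import Data.List.Properties using (map-tabulate)
open import Data.List.Membership.Propositional using (_∈_; _∉_)
open import Data.List.Membership.Propositional.Properties using (∈-allFin; ∈-map⁺; ∈-concatMap⁺; ∈-filter⁻)
open import Data.Product.Properties using (≡-dec)
open import Data.List.Membership.DecPropositional (≡-dec (F._≟_ {3}) (F._≟_ {3})) using (_∈?_)
open import Data.List.Relation.Unary.All using (_∷_)
import Data.List.Relation.Unary.All as All
open import Data.List.Relation.Unary.All.Properties using (all⁺; all⁻)
open import Data.List.Relation.Unary.AllPairs using (_∷_)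
open import Data.List.Relation.Unary.Any using (here; there)
import Data.List.Relation.Unary.Any as Any
open import Data.List.Relation.Unary.Unique.Propositional using (Unique)
open import Data.List.Relation.Unary.Unique.Propositional.Properties using (filter⁺; cartesianProduct⁺; allFin⁺)
open import Data.Nat.Base using (zero; suc; _+_; _*_; _<_; _<ᵇ_; _≡ᵇ_; z≤n; s≤s; z<s; s<s)
open import Data.Nat.Combinatorics.Base using (_P′_)
open import Data.Nat.Combinatorics.Specification using (nP′k≡n[n∸1P′k∸1])
open import Data.Nat.ListAction using (sum; product)
open import Data.Nat.Properties
open import Algebra.Properties.CommutativeSemigroup +-commutativeSemigroup using () renaming (x∙yz≈y∙xz to x+[y+z]≡y+[x+z])
open import Algebra.Properties.CommutativeSemigroup *-commutativeSemigroup using () renaming (x∙yz≈y∙xz to x*[y*z]≡y*[x*z])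
open import Data.Nat.Tactic.RingSolver using (solve-∀)
open import Data.Product.Base using (_,_; proj₁; proj₂; ∃-syntax)
open import Data.Product.Function.NonDependent.Propositional using (_×-⇔_)
open import Data.Sum.Base using (inj₁; inj₂)
open import Data.Unit.Base using (tt)
open import Data.Vec.Base using (Vec; []; _∷_; lookup)
open import Function.Base using (_∘_; id)
open import Function.Bundles using (_⇔_; mk⇔; Equivalence)
open import Function.Definitions using (Injective)
import Function.Properties.Equivalence as ⇔
open import Relation.Binary.Definitions using (tri<; tri≈; tri>)
open import Relation.Binary.PropositionalEquality using (refl; sym; trans; cong; cong₂; subst; subst₂; _≢_; module ≡-Reasoning)
open import Relation.Nullary.Decidable using (yes; no; ⌊_⌋)
open import Relation.Nullary.Negation using (¬_; contradiction)

private variable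
  X Y : Set

𝟙 : Bool → ℕ
𝟙 true  = 1
𝟙 false = 0

𝟙-∧ : ∀ x y → 𝟙 (x ∧ y) ≡ 𝟙 x * 𝟙 y
𝟙-∧ true  y = sym (+-identityʳ (𝟙 y))
𝟙-∧ false y = refl

T-ext : ∀ {x y} → T x ⇔ T y → x ≡ y
T-ext {false} {false} _ = refl
T-ext {false} {true}  e = ⊥-elim (Equivalence.from e tt)
T-ext {true}  {false} e = ⊥-elim (Equivalence.to e tt)
T-ext {true}  {true}  _ = refl

𝟙-guard : ∀ x {m n} → (T x → m ≡ n) → 𝟙 x * m ≡ 𝟙 x * n
𝟙-guard true  m≡n = cong (_+ 0) (m≡n tt)
𝟙-guard false _   = refl

T-not : ∀ {x} → T (not x) ⇔ (¬ T x)
T-not {false} = mk⇔ (λ _ ()) (λ _ → tt)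
T-not {true}  = mk⇔ (λ ()) (λ ¬t → ¬t tt)

𝟙-∧-cong : ∀ c {x y m k} → (T c → x ≡ y) → (T c → m ≡ k) → 𝟙 (c ∧ x) * m ≡ 𝟙 (c ∧ y) * k
𝟙-∧-cong true  x≡y m≡k = cong₂ (λ x m → 𝟙 x * m) (x≡y tt) (m≡k tt)
𝟙-∧-cong false _   _   = refl

𝟙-∧-* : ∀ x y m → 𝟙 x * (𝟙 y * m) ≡ 𝟙 (x ∧ y) * m
𝟙-∧-* true  y m = +-identityʳ (𝟙 y * m)
𝟙-∧-* false y m = refl

𝟙-⇔ : ∀ e₁ e₂ d o c s → (T d → (T e₁ × T e₂ × T o) ⇔ (T c × T s)) → 𝟙 e₁ * (𝟙 e₂ * 𝟙 (d ∧ o)) ≡ 𝟙 c * 𝟙 (d ∧ s)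
𝟙-⇔ e₁ e₂ false o c s _ = trans (cong (𝟙 e₁ *_) (*-zeroʳ (𝟙 e₂))) (trans (*-zeroʳ (𝟙 e₁)) (sym (*-zeroʳ (𝟙 c))))
𝟙-⇔ e₁ e₂ true  o c s h = begin
  𝟙 e₁ * (𝟙 e₂ * 𝟙 o)    ≡⟨ cong (𝟙 e₁ *_) (𝟙-∧ e₂ o) ⟨
  𝟙 e₁ * 𝟙 (e₂ ∧ o)      ≡⟨ 𝟙-∧ e₁ (e₂ ∧ o) ⟨
  𝟙 (e₁ ∧ (e₂ ∧ o))      ≡⟨ cong 𝟙 (T-ext (⇔.trans T-∧ (⇔.trans (⇔.refl ×-⇔ T-∧) (⇔.trans (h tt) (⇔.sym T-∧))))) ⟩
  𝟙 (c ∧ s)              ≡⟨ 𝟙-∧ c s ⟩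
  𝟙 c * 𝟙 s              ∎
  where open ≡-Reasoning

≡ᵇ-comm : ∀ m n → (m ≡ᵇ n) ≡ (n ≡ᵇ m)
≡ᵇ-comm zero    zero    = refl
≡ᵇ-comm zero    (suc n) = refl
≡ᵇ-comm (suc m) zero    = refl
≡ᵇ-comm (suc m) (suc n) = ≡ᵇ-comm m n

≡ᵇ-refl : ∀ n → (n ≡ᵇ n) ≡ true
≡ᵇ-refl n = Equivalence.to T-≡ (≡⇒≡ᵇ n n refl)

≡ᵇ-≢ : ∀ {m n} → m ≢ n → (m ≡ᵇ n) ≡ false
≡ᵇ-≢ {m} {n} m≢n = T-ext (mk⇔ (m≢n ∘ ≡ᵇ⇒≡ m n) λ ())

<ᵇ-true : ∀ {m n} → m < n → (m <ᵇ n) ≡ true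
<ᵇ-true m<n = Equivalence.to T-≡ (<⇒<ᵇ m<n)

<ᵇ-false : ∀ {m n} → n ≤ m → (m <ᵇ n) ≡ false
<ᵇ-false {m} {n} n≤m = T-ext (mk⇔ (λ m<n → contradiction (<ᵇ⇒< m n m<n) (≤⇒≯ n≤m)) λ ())

T-≢ᵇ : ∀ {m n} → T (not (m ≡ᵇ n)) ⇔ (m ≢ n)
T-≢ᵇ {m} {n} = ⇔.trans T-not (mk⇔ (λ ¬m≡ᵇn m≡n → ¬m≡ᵇn (≡⇒≡ᵇ m n m≡n)) (λ m≢n → m≢n ∘ ≡ᵇ⇒≡ m n))

T-all : (p : X → Bool) (xs : List X) → T (all p xs) ⇔ (∀ {x} → x ∈ xs → T (p x))
T-all p xs = mk⇔ (All.lookup ∘ all⁺ p xs) (all⁻ p ∘ All.tabulate)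

T-all-allFin : ∀ {n} (p : Fin n → Bool) → T (all p (allFin n)) ⇔ (∀ i → T (p i))
T-all-allFin {n} p = mk⇔ (λ h i → Equivalence.to (T-all p (allFin n)) h (∈-allFin i))
                         (λ h → Equivalence.from (T-all p (allFin n)) λ {i} _ → h i)

_≡ᶠ_ : ∀ {n} → Fin n → Fin n → Bool
i ≡ᶠ j = toℕ i ≡ᵇ toℕ j

≡ᶠ⇔≡ : ∀ {n} {i j : Fin n} → T (i ≡ᶠ j) ⇔ i ≡ j
≡ᶠ⇔≡ {i = i} {j} = mk⇔ (toℕ-injective ∘ ≡ᵇ⇒≡ (toℕ i) (toℕ j)) λ { refl → ≡⇒≡ᵇ (toℕ i) (toℕ i) refl }

∑ : List X → (X → ℕ) → ℕ
∑ xs f = sum (map f xs)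

∏ : List X → (X → ℕ) → ℕ
∏ xs f = product (map f xs)

∑< : ℕ → (ℕ → ℕ) → ℕ
∑< zero    f = 0
∑< (suc n) f = f 0 + ∑< n (f ∘ suc)

infix 5 ∑ ∏ ∑<

syntax ∑ xs (λ x → e) = ∑[ x ∈ xs ] e
syntax ∏ xs (λ x → e) = ∏[ x ∈ xs ] e
syntax ∑< n (λ i → e) = ∑[ i < n ] e

module _ {f g : X → ℕ} where

  ∑-cong : (xs : List X) → (∀ x → f x ≡ g x) → ∑ xs f ≡ ∑ xs g
  ∑-cong []       _   = refl
  ∑-cong (x ∷ xs) f≗g = cong₂ _+_ (f≗g x) (∑-cong xs f≗g)

  ∏-cong : (xs : List X) → (∀ x → f x ≡ g x) → ∏ xs f ≡ ∏ xs g
  ∏-cong []       _   = refl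
  ∏-cong (x ∷ xs) f≗g = cong₂ _*_ (f≗g x) (∏-cong xs f≗g)

  ∑-distrib-+ : (xs : List X) → ∑[ x ∈ xs ] (f x + g x) ≡ ∑ xs f + ∑ xs g
  ∑-distrib-+ []       = refl
  ∑-distrib-+ (x ∷ xs) = begin
    f x + g x + (∑[ x ∈ xs ] (f x + g x)) ≡⟨ cong (f x + g x +_) (∑-distrib-+ xs) ⟩
    f x + g x + (∑ xs f + ∑ xs g)       ≡⟨ +-assoc (f x) (g x) _ ⟩
    f x + (g x + (∑ xs f + ∑ xs g))     ≡⟨ cong (f x +_) (x+[y+z]≡y+[x+z] (g x) (∑ xs f) (∑ xs g)) ⟩
    f x + (∑ xs f + (g x + ∑ xs g))     ≡⟨ +-assoc (f x) (∑ xs f) _ ⟨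
    f x + ∑ xs f + (g x + ∑ xs g)       ∎
    where open ≡-Reasoning

∑-zero : (xs : List X) {f : X → ℕ} → (∀ x → f x ≡ 0) → ∑ xs f ≡ 0
∑-zero []       _   = refl
∑-zero (x ∷ xs) f≗0 = cong₂ _+_ (f≗0 x) (∑-zero xs f≗0)

*-distribˡ-∑ : (c : ℕ) (xs : List X) (f : X → ℕ) → c * ∑ xs f ≡ ∑[ x ∈ xs ] (c * f x)
*-distribˡ-∑ c []       f = *-zeroʳ c
*-distribˡ-∑ c (x ∷ xs) f = trans (*-distribˡ-+ c (f x) (∑ xs f)) (cong (c * f x +_) (*-distribˡ-∑ c xs f))

∑-++ : (xs ys : List X) (f : X → ℕ) → ∑ (xs ++ ys) f ≡ ∑ xs f + ∑ ys f
∑-++ []       ys f = refl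
∑-++ (x ∷ xs) ys f = trans (cong (f x +_) (∑-++ xs ys f)) (sym (+-assoc (f x) (∑ xs f) (∑ ys f)))

∑-map : (g : X → Y) (xs : List X) (f : Y → ℕ) → ∑ (map g xs) f ≡ ∑ xs (f ∘ g)
∑-map g []       f = refl
∑-map g (x ∷ xs) f = cong (f (g x) +_) (∑-map g xs f)

∑-concatMap : (g : X → List Y) (xs : List X) (f : Y → ℕ) → ∑ (concatMap g xs) f ≡ ∑[ x ∈ xs ] ∑ (g x) f
∑-concatMap g []       f = refl
∑-concatMap g (x ∷ xs) f = trans (∑-++ (g x) (concatMap g xs) f) (cong (∑ (g x) f +_) (∑-concatMap g xs f))

∑-comm : (xs : List X) (ys : List Y) (f : X → Y → ℕ) → ∑[ x ∈ xs ] ∑[ y ∈ ys ] f x y ≡ ∑[ y ∈ ys ] ∑[ x ∈ xs ] f x y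
∑-comm []       ys f = sym (∑-zero ys λ _ → refl)
∑-comm (x ∷ xs) ys f = trans (cong (∑ ys (f x) +_) (∑-comm xs ys f)) (sym (∑-distrib-+ ys))

length-filterᵇ : (p : X → Bool) (xs : List X) → length (filterᵇ p xs) ≡ ∑[ x ∈ xs ] 𝟙 (p x)
length-filterᵇ p []       = refl
length-filterᵇ p (x ∷ xs) with p x
... | true  = cong suc (length-filterᵇ p xs)
... | false = length-filterᵇ p xs

∑-filterᵇ : (p : X → Bool) (xs : List X) (f : X → ℕ) → ∑ (filterᵇ p xs) f ≡ ∑[ x ∈ xs ] 𝟙 (p x) * f x
∑-filterᵇ p []       f = refl
∑-filterᵇ p (x ∷ xs) f with p x
... | true  = cong₂ _+_ (sym (+-identityʳ (f x))) (∑-filterᵇ p xs f)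
... | false = ∑-filterᵇ p xs f

length-filterᵇ≤1 : (p : X → Bool) (xs : List X) → Unique xs → (∀ {x y} → T (p x) → T (p y) → x ≡ y) → length (filterᵇ p xs) ≤ 1
length-filterᵇ≤1 p xs unique same = length≤1 {ys = filterᵇ p xs} (filter⁺ (T? ∘ p) unique) λ x∈ y∈ →
  same (proj₂ (∈-filter⁻ (T? ∘ p) {xs = xs} x∈)) (proj₂ (∈-filter⁻ (T? ∘ p) {xs = xs} y∈))
  where
  length≤1 : ∀ {ys : List X} → Unique ys → (∀ {x y} → x ∈ ys → y ∈ ys → x ≡ y) → length ys ≤ 1
  length≤1 {ys = []}        _               _    = z≤n
  length≤1 {ys = _ ∷ []}    _               _    = s≤s z≤n
  length≤1 {ys = _ ∷ _ ∷ _} ((x≢y ∷ _) ∷ _) same = contradiction (same (here refl) (there (here refl))) x≢y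

concatMap≡cartesianProduct : (xs : List X) (ys : List Y) → concatMap (λ x → map (x ,_) ys) xs ≡ cartesianProduct xs ys
concatMap≡cartesianProduct []       ys = refl
concatMap≡cartesianProduct (x ∷ xs) ys = cong (map (x ,_) ys ++_) (concatMap≡cartesianProduct xs ys)

∑-member : ∀ {xs : List X} {x} {f : X → ℕ} {m} → x ∈ xs → m ≤ f x → m ≤ ∑ xs f
∑-member {xs = x ∷ xs} {f = f} (here refl) m≤fx = ≤-trans m≤fx (m≤m+n (f x) (∑ xs f))
∑-member {xs = y ∷ xs} {f = f} (there x∈xs) m≤fx = ≤-trans (∑-member x∈xs m≤fx) (m≤n+m (∑ xs f) (f y))

∑-allFin-suc : ∀ n (f : Fin (suc n) → ℕ) → ∑ (allFin (suc n)) f ≡ f fzero + (∑[ i ∈ allFin n ] f (fsuc i))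
∑-allFin-suc n f = cong (f fzero +_) (trans (cong (λ xs → ∑ xs f) (sym (map-tabulate id fsuc))) (∑-map fsuc (allFin n) f))

∑-allFin-point : ∀ {n} (y : Fin n) (f : Fin n → ℕ) → ∑[ x ∈ allFin n ] 𝟙 (x ≡ᶠ y) * f x ≡ f y
∑-allFin-point {suc n} fzero f = begin
  ∑[ x ∈ allFin (suc n) ] 𝟙 (x ≡ᶠ fzero) * f x    ≡⟨ ∑-allFin-suc n (λ x → 𝟙 (x ≡ᶠ fzero) * f x) ⟩
  f fzero + 0 + (∑[ x ∈ allFin n ] 0)             ≡⟨ cong₂ _+_ (+-identityʳ (f fzero)) (∑-zero (allFin n) λ _ → refl) ⟩
  f fzero + 0                                     ≡⟨ +-identityʳ (f fzero) ⟩
  f fzero                                         ∎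
  where open ≡-Reasoning
∑-allFin-point {suc n} (fsuc y) f = trans (∑-allFin-suc n (λ x → 𝟙 (x ≡ᶠ fsuc y) * f x)) (∑-allFin-point y (f ∘ fsuc))

∏-allFin-suc : ∀ n (f : Fin (suc n) → ℕ) → ∏ (allFin (suc n)) f ≡ f fzero * (∏[ i ∈ allFin n ] f (fsuc i))
∏-allFin-suc n f = cong (f fzero *_) (trans (cong (λ xs → ∏ xs f) (sym (map-tabulate id fsuc))) (∏-map (allFin n)))
  where
  ∏-map : (xs : List (Fin n)) → ∏ (map fsuc xs) f ≡ ∏ xs (f ∘ fsuc)
  ∏-map []       = refl
  ∏-map (x ∷ xs) = cong (f (fsuc x) *_) (∏-map xs)

∏-one : (xs : List X) → ∏[ x ∈ xs ] 1 ≡ 1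
∏-one []       = refl
∏-one (x ∷ xs) = trans (+-identityʳ _) (∏-one xs)

∑<-allFin : ∀ n (f : ℕ → ℕ) → ∑[ i ∈ allFin n ] f (toℕ i) ≡ ∑< n f
∑<-allFin zero    f = refl
∑<-allFin (suc n) f = trans (∑-allFin-suc n (f ∘ toℕ)) (cong (f 0 +_) (∑<-allFin n (f ∘ suc)))

∑<-cong : ∀ n {f g : ℕ → ℕ} → (∀ i → i < n → f i ≡ g i) → ∑< n f ≡ ∑< n g
∑<-cong zero    _   = refl
∑<-cong (suc n) f≗g = cong₂ _+_ (f≗g 0 z<s) (∑<-cong n λ i i<n → f≗g (suc i) (s<s i<n))

∑<-zero : ∀ n {f : ℕ → ℕ} → (∀ i → i < n → f i ≡ 0) → ∑< n f ≡ 0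
∑<-zero zero    _   = refl
∑<-zero (suc n) f≗0 = cong₂ _+_ (f≗0 0 z<s) (∑<-zero n λ i i<n → f≗0 (suc i) (s<s i<n))

*-distribˡ-∑< : ∀ n c (f : ℕ → ℕ) → c * ∑< n f ≡ ∑[ i < n ] (c * f i)
*-distribˡ-∑< zero    c f = *-zeroʳ c
*-distribˡ-∑< (suc n) c f = trans (*-distribˡ-+ c (f 0) (∑< n (f ∘ suc))) (cong (c * f 0 +_) (*-distribˡ-∑< n c (f ∘ suc)))

∑<-comm : ∀ m n (f : ℕ → ℕ → ℕ) → ∑[ i < m ] ∑[ j < n ] f i j ≡ ∑[ j < n ] ∑[ i < m ] f i j
∑<-comm m n f = begin
  ∑[ i < m ] ∑[ j < n ] f i j                                     ≡⟨ ∑<-allFin m _ ⟨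
  ∑[ i ∈ allFin m ] ∑[ j < n ] f (toℕ i) j                        ≡⟨ ∑-cong (allFin m) (λ i → ∑<-allFin n _) ⟨
  ∑[ i ∈ allFin m ] ∑[ j ∈ allFin n ] f (toℕ i) (toℕ j)           ≡⟨ ∑-comm (allFin m) (allFin n) _ ⟩
  ∑[ j ∈ allFin n ] ∑[ i ∈ allFin m ] f (toℕ i) (toℕ j)           ≡⟨ ∑-cong (allFin n) (λ j → ∑<-allFin m _) ⟩
  ∑[ j ∈ allFin n ] ∑[ i < m ] f i (toℕ j)                        ≡⟨ ∑<-allFin n _ ⟩
  ∑[ j < n ] ∑[ i < m ] f i j                                     ∎
  where open ≡-Reasoning

∑-∑<-comm : (xs : List X) (n : ℕ) (f : X → ℕ → ℕ) → ∑[ x ∈ xs ] ∑[ i < n ] f x i ≡ ∑[ i < n ] ∑[ x ∈ xs ] f x i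
∑-∑<-comm xs n f = begin
  ∑[ x ∈ xs ] ∑[ i < n ] f x i                    ≡⟨ ∑-cong xs (λ x → ∑<-allFin n (f x)) ⟨
  ∑[ x ∈ xs ] ∑[ i ∈ allFin n ] f x (toℕ i)       ≡⟨ ∑-comm xs (allFin n) (λ x i → f x (toℕ i)) ⟩
  ∑[ i ∈ allFin n ] ∑[ x ∈ xs ] f x (toℕ i)       ≡⟨ ∑<-allFin n (λ i → ∑[ x ∈ xs ] f x i) ⟩
  ∑[ i < n ] ∑[ x ∈ xs ] f x i                    ∎
  where open ≡-Reasoning

∑<-init-last : ∀ n (f : ℕ → ℕ) → ∑< (suc n) f ≡ ∑< n f + f n
∑<-init-last zero    f = +-comm (f 0) 0
∑<-init-last (suc n) f = trans (cong (f 0 +_) (∑<-init-last n (f ∘ suc))) (sym (+-assoc (f 0) _ _))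

∑<-reflect : ∀ n (f : ℕ → ℕ) → ∑< n f ≡ ∑[ i < n ] f (n ∸ suc i)
∑<-reflect zero    f = refl
∑<-reflect (suc n) f = begin
  f 0 + ∑< n (f ∘ suc)                    ≡⟨ cong (f 0 +_) (∑<-reflect n (f ∘ suc)) ⟩
  f 0 + (∑[ i < n ] f (suc (n ∸ suc i)))  ≡⟨ cong (f 0 +_) (∑<-cong n λ i i<n → cong f (sym (+-∸-assoc 1 i<n))) ⟩
  f 0 + (∑[ i < n ] f (n ∸ i))            ≡⟨ +-comm (f 0) _ ⟩
  (∑[ i < n ] f (n ∸ i)) + f 0            ≡⟨ cong (λ m → (∑[ i < n ] f (n ∸ i)) + f m) (n∸n≡0 n) ⟨
  (∑[ i < n ] f (n ∸ i)) + f (n ∸ n)      ≡⟨ ∑<-init-last n (λ i → f (n ∸ i)) ⟨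
  ∑[ i < suc n ] f (n ∸ i)                ∎
  where open ≡-Reasoning

∑<-point : ∀ {n x} (f : ℕ → ℕ) → x < n → ∑[ i < n ] 𝟙 (i ≡ᵇ x) * f i ≡ f x
∑<-point {suc n} {zero}  f _         =
  trans (cong₂ _+_ (+-identityʳ (f 0)) (∑<-zero n λ _ _ → refl)) (+-identityʳ (f 0))
∑<-point {suc n} {suc x} f (s≤s x<n) = ∑<-point (f ∘ suc) x<n

∑<-below : ∀ {n p} → p ≤ n → ∑[ z < n ] 𝟙 (z <ᵇ p) ≡ p
∑<-below {zero}  z≤n       = refl
∑<-below {suc n} {zero}  _ = ∑<-zero n λ _ _ → refl
∑<-below {suc n} {suc p} (s≤s p≤n) = cong suc (∑<-below p≤n)

∑<-between : ∀ {n} p {q} → q ≤ n → ∑[ z < n ] 𝟙 ((p <ᵇ z) ∧ (z <ᵇ q)) ≡ q ∸ suc p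
∑<-between {zero}  p       z≤n       = refl
∑<-between {suc n} p       {zero} _  = ∑<-zero (suc n) λ z _ → cong 𝟙 (∧-zeroʳ (p <ᵇ z))
∑<-between {suc n} zero    {suc q} (s≤s q≤n) = ∑<-below q≤n
∑<-between {suc n} (suc p) {suc q} (s≤s q≤n) = ∑<-between p q≤n

P′-zero : ∀ {t c} → t < c → t P′ c ≡ 0
P′-zero {t} {suc c} (s≤s t≤c) = cong (_* (t P′ c)) (m≤n⇒m∸n≡0 t≤c)

P′-diag : ∀ n → n P′ n ≡ n !
P′-diag zero    = refl
P′-diag (suc n) = trans (nP′k≡n[n∸1P′k∸1] (suc n) (suc n)) (cong (suc n *_) (P′-diag n))

module _ (t c : X → ℕ) where

  ∏-P′≡0 : (xs : List X) → ∑ xs t < ∑ xs c → ∏[ x ∈ xs ] (t x P′ c x) ≡ 0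
  ∏-P′≡0 (x ∷ xs) ∑t<∑c with ≤-<-connex (c x) (t x)
  ... | inj₂ tx<cx = cong (λ z → z * (∏[ y ∈ xs ] (t y P′ c y))) (P′-zero tx<cx)
  ... | inj₁ cx≤tx = trans (cong ((t x P′ c x) *_) (∏-P′≡0 xs rest<)) (*-zeroʳ (t x P′ c x))
    where
    rest< : ∑ xs t < ∑ xs c
    rest< = +-cancelˡ-< (c x) _ _ (≤-<-trans (+-monoˡ-≤ (∑ xs t) cx≤tx) ∑t<∑c)

  ∏-P′ : (xs : List X) → ∑ xs t ≤ ∑ xs c →
         ∏[ x ∈ xs ] (t x P′ c x) ≡ 𝟙 (all (λ x → t x ≡ᵇ c x) xs) * (∏[ x ∈ xs ] c x !)
  ∏-P′ []       _ = refl
  ∏-P′ (x ∷ xs) ∑t≤∑c with <-cmp (t x) (c x)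
  ... | tri< tx<cx _ _ rewrite P′-zero tx<cx | ≡ᵇ-≢ (<⇒≢ tx<cx) = refl
  ... | tri≈ _ tx≡cx _ rewrite tx≡cx | ≡ᵇ-refl (c x) | P′-diag (c x)
      | ∏-P′ xs (+-cancelˡ-≤ (c x) _ _ ∑t≤∑c) = x*[y*z]≡y*[x*z] (c x !) (𝟙 (all (λ x → t x ≡ᵇ c x) xs)) _
  ... | tri> _ tx≢cx cx<tx rewrite ≡ᵇ-≢ tx≢cx =
    trans (cong ((t x P′ c x) *_) (∏-P′≡0 xs (+-cancelˡ-< (c x) _ _ (<-≤-trans (+-monoˡ-< (∑ xs t) cx<tx) ∑t≤∑c)))) (*-zeroʳ (t x P′ c x))

P′-step : ∀ {r} (s c : Fin r → ℕ) (G₀ : Fin r) →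
          ∏[ G ∈ allFin r ] (s G P′ (𝟙 (G₀ ≡ᶠ G) + c G)) ≡ (s G₀ ∸ c G₀) * (∏[ G ∈ allFin r ] (s G P′ c G))
P′-step {suc r} s c fzero = begin
  ∏[ G ∈ allFin (suc r) ] (s G P′ (𝟙 (fzero ≡ᶠ G) + c G))       ≡⟨ ∏-allFin-suc r (λ G → s G P′ (𝟙 (fzero ≡ᶠ G) + c G)) ⟩
  (s fzero ∸ c fzero) * (s fzero P′ c fzero) * rest              ≡⟨ *-assoc (s fzero ∸ c fzero) _ rest ⟩
  (s fzero ∸ c fzero) * ((s fzero P′ c fzero) * rest)            ≡⟨ cong ((s fzero ∸ c fzero) *_) (∏-allFin-suc r (λ G → s G P′ c G)) ⟨
  (s fzero ∸ c fzero) * (∏[ G ∈ allFin (suc r) ] (s G P′ c G))   ∎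
  where
  open ≡-Reasoning
  rest = ∏[ G ∈ allFin r ] (s (fsuc G) P′ c (fsuc G))
P′-step {suc r} s c (fsuc G₀) = begin
  ∏[ G ∈ allFin (suc r) ] (s G P′ (𝟙 (fsuc G₀ ≡ᶠ G) + c G))       ≡⟨ ∏-allFin-suc r (λ G → s G P′ (𝟙 (fsuc G₀ ≡ᶠ G) + c G)) ⟩
  (s fzero P′ c fzero) * (∏[ G ∈ allFin r ] (s (fsuc G) P′ (𝟙 (G₀ ≡ᶠ G) + c (fsuc G))))
                                                                   ≡⟨ cong ((s fzero P′ c fzero) *_) (P′-step (s ∘ fsuc) (c ∘ fsuc) G₀) ⟩
  (s fzero P′ c fzero) * (d * rest)                                ≡⟨ x*[y*z]≡y*[x*z] (s fzero P′ c fzero) d rest ⟩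
  d * ((s fzero P′ c fzero) * rest)                                ≡⟨ cong (d *_) (∏-allFin-suc r (λ G → s G P′ c G)) ⟨
  d * (∏[ G ∈ allFin (suc r) ] (s G P′ c G))                       ∎
  where
  open ≡-Reasoning
  d = s (fsuc G₀) ∸ c (fsuc G₀)
  rest = ∏[ G ∈ allFin r ] (s (fsuc G) P′ c (fsuc G))

-- Counting injective words with prescribed labels

_∈ᵇ_ : ∀ {m l} → Fin m → Vec (Fin m) l → Bool
x ∈ᵇ []      = false
x ∈ᵇ (y ∷ v) = (x ≡ᶠ y) ∨ (x ∈ᵇ v)

distinct : ∀ {m l} → Vec (Fin m) l → Bool
distinct []      = true
distinct (x ∷ v) = not (x ∈ᵇ v) ∧ distinct v

∈ᵇ⇔∃ : ∀ {m l} {x : Fin m} (v : Vec (Fin m) l) → T (x ∈ᵇ v) ⇔ (∃[ k ] lookup v k ≡ x)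
∈ᵇ⇔∃ {x = x} v = mk⇔ (to v) (λ (k , vk≡x) → from v k vk≡x)
  where
  to : ∀ {l} (v : Vec _ l) → T (x ∈ᵇ v) → ∃[ k ] lookup v k ≡ x
  to (y ∷ v) x∈ with Equivalence.to T-∨ x∈
  ... | inj₁ x≡y = fzero , sym (Equivalence.to ≡ᶠ⇔≡ x≡y)
  ... | inj₂ x∈v = let k , vk≡x = to v x∈v in fsuc k , vk≡x
  from : ∀ {l} (v : Vec _ l) k → lookup v k ≡ x → T (x ∈ᵇ v)
  from (y ∷ v) fzero    refl  = Equivalence.from (T-∨ {y ≡ᶠ y}) (inj₁ (Equivalence.from (≡ᶠ⇔≡ {i = y}) refl))
  from (y ∷ v) (fsuc k) vk≡x  = Equivalence.from (T-∨ {x ≡ᶠ y}) (inj₂ (from v k vk≡x))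

distinct⇔injective : ∀ {m l} (v : Vec (Fin m) l) → T (distinct v) ⇔ Injective _≡_ _≡_ (lookup v)
distinct⇔injective v = mk⇔ (to v) (from v)
  where
  to : ∀ {l} (v : Vec _ l) → T (distinct v) → Injective _≡_ _≡_ (lookup v)
  to (x ∷ v) d {fzero}  {fzero}  _  = refl
  to (x ∷ v) d {fzero}  {fsuc j} eq = contradiction (Equivalence.from (∈ᵇ⇔∃ v) (j , sym eq)) (Equivalence.to T-not (proj₁ (Equivalence.to T-∧ d)))
  to (x ∷ v) d {fsuc i} {fzero}  eq = contradiction (Equivalence.from (∈ᵇ⇔∃ v) (i , eq)) (Equivalence.to T-not (proj₁ (Equivalence.to T-∧ d)))
  to (x ∷ v) d {fsuc i} {fsuc j} eq = cong fsuc (to v (proj₂ (Equivalence.to T-∧ d)) eq)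
  from : ∀ {l} (v : Vec _ l) → Injective _≡_ _≡_ (lookup v) → T (distinct v)
  from []      _   = tt
  from (x ∷ v) inj = Equivalence.from T-∧ (x∉v , from v (fsuc-injective ∘ inj))
    where
    x∉v : T (not (x ∈ᵇ v))
    x∉v = Equivalence.from T-not λ x∈v → let k , vk≡x = Equivalence.to (∈ᵇ⇔∃ v) x∈v in
                                          contradiction (inj {fzero} {fsuc k} (sym vk≡x)) λ ()

∈-allVecs : ∀ {m l} (v : Vec (Fin m) l) → v ∈ allVecs m l
∈-allVecs []      = here refl
∈-allVecs {m} (x ∷ v) = ∈-concatMap⁺ (λ w → map (_∷ w) (allFin m)) (Any.map (λ { refl → ∈-map⁺ (_∷ v) (∈-allFin x) }) (∈-allVecs v))

isInjective⇔injective : ∀ {n} (π : Word n) → T (isInjective π) ⇔ Injective _≡_ _≡_ (lookup π)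
isInjective⇔injective {n} π = mk⇔
  (λ h {i} {j} → Equivalence.to (pair⇔ i j) (Equivalence.to (T-all-allFin _) (Equivalence.to (T-all-allFin _) h i) j))
  (λ inj → Equivalence.from (T-all-allFin _) λ i → Equivalence.from (T-all-allFin _) λ j → Equivalence.from (pair⇔ i j) inj)
  where
  pair⇔ : ∀ i j → T (not ⌊ lookup π i F.≟ lookup π j ⌋ ∨ ⌊ i F.≟ j ⌋) ⇔ (lookup π i ≡ lookup π j → i ≡ j)
  pair⇔ i j with lookup π i F.≟ lookup π j | i F.≟ j
  ... | yes _     | yes i≡j = mk⇔ (λ _ _ → i≡j) (λ _ → tt)
  ... | yes πi≡πj | no i≢j  = mk⇔ (λ ()) (λ inj → i≢j (inj πi≡πj))
  ... | no πi≢πj  | _       = mk⇔ (λ _ πi≡πj → contradiction πi≡πj πi≢πj) (λ _ → tt)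

isInjective≡distinct : ∀ {n} (π : Word n) → isInjective π ≡ distinct π
isInjective≡distinct π = T-ext (⇔.trans (isInjective⇔injective π) (⇔.sym (distinct⇔injective π)))

fibre : ∀ {m r} → (Fin m → Fin r) → Fin r → ℕ
fibre {m} f G = ∑[ x ∈ allFin m ] 𝟙 (f x ≡ᶠ G)

module _ {m r : ℕ} (ρ : Fin m → Fin r) where

  respects : ∀ {l} → (Fin l → Fin r) → Vec (Fin m) l → Bool
  respects κ []      = true
  respects κ (x ∷ v) = (ρ x ≡ᶠ κ fzero) ∧ respects (κ ∘ fsuc) v

  respects⇔ : ∀ {l} (κ : Fin l → Fin r) (v : Vec (Fin m) l) → T (respects κ v) ⇔ (∀ k → ρ (lookup v k) ≡ κ k)
  respects⇔ κ v = mk⇔ (to κ v) (from κ v)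
    where
    to : ∀ {l} (κ : Fin l → Fin r) (v : Vec (Fin m) l) → T (respects κ v) → ∀ k → ρ (lookup v k) ≡ κ k
    to κ (x ∷ v) h fzero    = Equivalence.to ≡ᶠ⇔≡ (proj₁ (Equivalence.to T-∧ h))
    to κ (x ∷ v) h (fsuc k) = to (κ ∘ fsuc) v (proj₂ (Equivalence.to (T-∧ {ρ x ≡ᶠ κ fzero}) h)) k
    from : ∀ {l} (κ : Fin l → Fin r) (v : Vec (Fin m) l) → (∀ k → ρ (lookup v k) ≡ κ k) → T (respects κ v)
    from κ []      _ = tt
    from κ (x ∷ v) h = Equivalence.from T-∧ (Equivalence.from ≡ᶠ⇔≡ (h fzero) , from (κ ∘ fsuc) v (h ∘ fsuc))

  private
    𝟙-∧-∨ : ∀ a b c → ¬ (T b × T c) → 𝟙 (a ∧ (b ∨ c)) ≡ 𝟙 b * 𝟙 a + 𝟙 (a ∧ c)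
    𝟙-∧-∨ false false c     _ = refl
    𝟙-∧-∨ false true  c     _ = refl
    𝟙-∧-∨ true  false c     _ = refl
    𝟙-∧-∨ true  true  false _ = refl
    𝟙-∧-∨ true  true  true  ¬both = contradiction (tt , tt) ¬both

    𝟙-∧-not : ∀ a b → 𝟙 (a ∧ not b) + 𝟙 (a ∧ b) ≡ 𝟙 a
    𝟙-∧-not false b     = refl
    𝟙-∧-not true  false = refl
    𝟙-∧-not true  true  = refl

  count-∈ᵇ : ∀ {l} (κ : Fin l → Fin r) (v : Vec (Fin m) l) → T (distinct v) → T (respects κ v) →
             ∀ G → ∑[ x ∈ allFin m ] 𝟙 ((ρ x ≡ᶠ G) ∧ (x ∈ᵇ v)) ≡ fibre κ G
  count-∈ᵇ κ []      _ _ G = ∑-zero (allFin m) λ x → cong 𝟙 (∧-zeroʳ (ρ x ≡ᶠ G))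
  count-∈ᵇ {suc l} κ (y ∷ v) d resp G = begin
    ∑[ x ∈ allFin m ] 𝟙 ((ρ x ≡ᶠ G) ∧ ((x ≡ᶠ y) ∨ (x ∈ᵇ v)))
      ≡⟨ ∑-cong (allFin m) (λ x → 𝟙-∧-∨ (ρ x ≡ᶠ G) (x ≡ᶠ y) (x ∈ᵇ v) λ (x≡y , x∈v) →
           Equivalence.to T-not y∉v (subst (λ z → T (z ∈ᵇ v)) (Equivalence.to (≡ᶠ⇔≡ {i = x}) x≡y) x∈v)) ⟩
    ∑[ x ∈ allFin m ] (𝟙 (x ≡ᶠ y) * 𝟙 (ρ x ≡ᶠ G) + 𝟙 ((ρ x ≡ᶠ G) ∧ (x ∈ᵇ v)))
      ≡⟨ ∑-distrib-+ (allFin m) ⟩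
    (∑[ x ∈ allFin m ] 𝟙 (x ≡ᶠ y) * 𝟙 (ρ x ≡ᶠ G)) + (∑[ x ∈ allFin m ] 𝟙 ((ρ x ≡ᶠ G) ∧ (x ∈ᵇ v)))
      ≡⟨ cong₂ _+_ (∑-allFin-point y (λ x → 𝟙 (ρ x ≡ᶠ G))) (count-∈ᵇ (κ ∘ fsuc) v distinct-v resp-v G) ⟩
    𝟙 (ρ y ≡ᶠ G) + fibre (κ ∘ fsuc) G
      ≡⟨ cong (λ z → 𝟙 (z ≡ᶠ G) + fibre (κ ∘ fsuc) G) ρy≡κ0 ⟩
    𝟙 (κ fzero ≡ᶠ G) + fibre (κ ∘ fsuc) G
      ≡⟨ ∑-allFin-suc l (λ k → 𝟙 (κ k ≡ᶠ G)) ⟨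
    fibre κ G ∎
    where
    open ≡-Reasoning
    y∉v = proj₁ (Equivalence.to (T-∧ {not (y ∈ᵇ v)}) d)
    distinct-v = proj₂ (Equivalence.to (T-∧ {not (y ∈ᵇ v)}) d)
    ρy≡κ0 = Equivalence.to (≡ᶠ⇔≡ {i = ρ y}) (proj₁ (Equivalence.to (T-∧ {ρ y ≡ᶠ κ fzero}) resp))
    resp-v = proj₂ (Equivalence.to (T-∧ {ρ y ≡ᶠ κ fzero}) resp)

  count-∉ᵇ : ∀ {l} (κ : Fin l → Fin r) (v : Vec (Fin m) l) → T (distinct v) → T (respects κ v) →
             ∀ G → ∑[ x ∈ allFin m ] 𝟙 ((ρ x ≡ᶠ G) ∧ not (x ∈ᵇ v)) ≡ fibre ρ G ∸ fibre κ G
  count-∉ᵇ κ v d resp G = begin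
    ∑[ x ∈ allFin m ] 𝟙 ((ρ x ≡ᶠ G) ∧ not (x ∈ᵇ v))                 ≡⟨ m+n∸n≡m _ (fibre κ G) ⟨
    (∑[ x ∈ allFin m ] 𝟙 ((ρ x ≡ᶠ G) ∧ not (x ∈ᵇ v))) + fibre κ G ∸ fibre κ G
      ≡⟨ cong (λ z → (∑[ x ∈ allFin m ] 𝟙 ((ρ x ≡ᶠ G) ∧ not (x ∈ᵇ v))) + z ∸ fibre κ G) (count-∈ᵇ κ v d resp G) ⟨
    (∑[ x ∈ allFin m ] 𝟙 ((ρ x ≡ᶠ G) ∧ not (x ∈ᵇ v))) + (∑[ x ∈ allFin m ] 𝟙 ((ρ x ≡ᶠ G) ∧ (x ∈ᵇ v))) ∸ fibre κ G
      ≡⟨ cong (_∸ fibre κ G) (trans (sym (∑-distrib-+ (allFin m))) (∑-cong (allFin m) λ x → 𝟙-∧-not (ρ x ≡ᶠ G) (x ∈ᵇ v))) ⟩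
    fibre ρ G ∸ fibre κ G                                               ∎
    where open ≡-Reasoning

  -- For v = x ∷ w, the admissible x are the values labelled κ 0 that w does not use.
  count-injective-respecting : ∀ l (κ : Fin l → Fin r) →
    ∑[ v ∈ allVecs m l ] 𝟙 (distinct v ∧ respects κ v) ≡ ∏[ G ∈ allFin r ] (fibre ρ G P′ fibre κ G)
  count-injective-respecting zero    κ = sym (∏-one (allFin r))
  count-injective-respecting (suc l) κ = begin
    ∑[ v ∈ allVecs m (suc l) ] 𝟙 (distinct v ∧ respects κ v)
      ≡⟨ ∑-concatMap (λ w → map (_∷ w) (allFin m)) (allVecs m l) _ ⟩
    ∑[ w ∈ allVecs m l ] ∑ (map (_∷ w) (allFin m)) (λ v → 𝟙 (distinct v ∧ respects κ v))
      ≡⟨ ∑-cong (allVecs m l) (λ w → trans (∑-map (_∷ w) (allFin m) _) (∑-cong (allFin m) λ x → split x w)) ⟩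
    ∑[ w ∈ allVecs m l ] ∑[ x ∈ allFin m ] 𝟙 (distinct w ∧ respects κ′ w) * 𝟙 ((ρ x ≡ᶠ κ fzero) ∧ not (x ∈ᵇ w))
      ≡⟨ ∑-cong (allVecs m l) (λ w → sym (*-distribˡ-∑ (𝟙 (distinct w ∧ respects κ′ w)) (allFin m)
                                                      (λ x → 𝟙 ((ρ x ≡ᶠ κ fzero) ∧ not (x ∈ᵇ w))))) ⟩
    ∑[ w ∈ allVecs m l ] 𝟙 (distinct w ∧ respects κ′ w) * (∑[ x ∈ allFin m ] 𝟙 ((ρ x ≡ᶠ κ fzero) ∧ not (x ∈ᵇ w)))
      ≡⟨ ∑-cong (allVecs m l) (λ w → 𝟙-guard (distinct w ∧ respects κ′ w) λ h →
           count-∉ᵇ κ′ w (proj₁ (Equivalence.to (T-∧ {distinct w}) h)) (proj₂ (Equivalence.to (T-∧ {distinct w}) h)) (κ fzero)) ⟩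
    ∑[ w ∈ allVecs m l ] 𝟙 (distinct w ∧ respects κ′ w) * d
      ≡⟨ ∑-cong (allVecs m l) (λ w → *-comm _ d) ⟩
    ∑[ w ∈ allVecs m l ] d * 𝟙 (distinct w ∧ respects κ′ w)
      ≡⟨ *-distribˡ-∑ d (allVecs m l) _ ⟨
    d * (∑[ w ∈ allVecs m l ] 𝟙 (distinct w ∧ respects κ′ w))
      ≡⟨ cong (d *_) (count-injective-respecting l κ′) ⟩
    d * (∏[ G ∈ allFin r ] (fibre ρ G P′ fibre κ′ G))
      ≡⟨ P′-step (fibre ρ) (fibre κ′) (κ fzero) ⟨
    ∏[ G ∈ allFin r ] (fibre ρ G P′ (𝟙 (κ fzero ≡ᶠ G) + fibre κ′ G))
      ≡⟨ ∏-cong (allFin r) (λ G → cong (fibre ρ G P′_) (∑-allFin-suc l (λ k → 𝟙 (κ k ≡ᶠ G)))) ⟨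
    ∏[ G ∈ allFin r ] (fibre ρ G P′ fibre κ G) ∎
    where
    open ≡-Reasoning
    κ′ = κ ∘ fsuc
    d = fibre ρ (κ fzero) ∸ fibre κ′ (κ fzero)
    split : ∀ x w → 𝟙 (distinct (x ∷ w) ∧ respects κ (x ∷ w))
                  ≡ 𝟙 (distinct w ∧ respects κ′ w) * 𝟙 ((ρ x ≡ᶠ κ fzero) ∧ not (x ∈ᵇ w))
    split x w = trans (cong 𝟙 (interchange (not (x ∈ᵇ w)) (distinct w) (ρ x ≡ᶠ κ fzero) (respects κ′ w)))
                      (𝟙-∧ (distinct w ∧ respects κ′ w) _)
      where
      interchange : ∀ a b c e → (a ∧ b) ∧ (c ∧ e) ≡ (b ∧ e) ∧ (c ∧ a)
      interchange false b c e = sym (trans (cong ((b ∧ e) ∧_) (∧-zeroʳ c)) (∧-zeroʳ (b ∧ e)))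
      interchange true  b false e = trans (∧-zeroʳ b) (sym (∧-zeroʳ (b ∧ e)))
      interchange true  b true  e = sym (∧-identityʳ (b ∧ e))

count-permutations : ∀ n → ∑[ π ∈ allVecs n n ] 𝟙 (distinct π) ≡ n !
count-permutations n = begin
  ∑[ π ∈ allVecs n n ] 𝟙 (distinct π)                          ≡⟨ ∑-cong (allVecs n n) (λ π → cong 𝟙 (sym (∧-identityʳ (distinct π)))) ⟩
  ∑[ π ∈ allVecs n n ] 𝟙 (distinct π ∧ true)
    ≡⟨ ∑-cong (allVecs n n) (λ π → cong (λ b → 𝟙 (distinct π ∧ b)) (trivially-respects π)) ⟨
  ∑[ π ∈ allVecs n n ] 𝟙 (distinct π ∧ respects point point π) ≡⟨ count-injective-respecting point n point ⟩
  (fibre point fzero P′ fibre point fzero) * 1                 ≡⟨ *-identityʳ (fibre point fzero P′ fibre point fzero) ⟩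
  fibre point fzero P′ fibre point fzero                       ≡⟨ cong₂ _P′_ fibre-point fibre-point ⟩
  n P′ n                                                       ≡⟨ P′-diag n ⟩
  n !                                                          ∎
  where
  open ≡-Reasoning
  point : Fin n → Fin 1
  point _ = fzero
  trivially-respects : ∀ {l} (v : Vec (Fin n) l) → respects point (λ _ → fzero) v ≡ true
  trivially-respects []      = refl
  trivially-respects (x ∷ v) = trivially-respects v
  fibre-point : fibre point fzero ≡ n
  fibre-point = trans (∑<-allFin n (λ _ → 1)) (∑<-const-1 n)
    where
    ∑<-const-1 : ∀ n → ∑[ _ < n ] 1 ≡ n
    ∑<-const-1 zero    = refl
    ∑<-const-1 (suc n) = cong suc (∑<-const-1 n)

-- Strips and block labels

-- isOcc's test for z lying strictly inside the c-th strip that p < q cut out of [0, n)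
-- (Defs counts positions and values from 1).
inStrip : ℕ → ℕ → ℕ → Fin 3 → ℕ → Bool
inStrip n p q c z = (bnd 0 (suc p) (suc q) (suc n) (F.inject₁ c) <ᵇ suc z) ∧ (suc z <ᵇ bnd 0 (suc p) (suc q) (suc n) (fsuc c))

stripOf : Bool → Bool → Fin 3
stripOf true  _     = fzero
stripOf false true  = fsuc fzero
stripOf false false = fsuc (fsuc fzero)

-- Junk for z ∈ {p, q}.
strip : ℕ → ℕ → ℕ → Fin 3
strip p q z = stripOf (z <ᵇ p) (z <ᵇ q)

module _ {n p q : ℕ} (p<q : p < q) where

  inStrip⇒ : ∀ {z} c → T (inStrip n p q c z) → z ≢ p × z ≢ q × c ≡ strip p q z
  inStrip⇒ {z} fzero z<ᵇp = <⇒≢ z<p , <⇒≢ (<-trans z<p p<q) , sym (cong (λ b → stripOf b (z <ᵇ q)) (<ᵇ-true z<p))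
    where z<p = <ᵇ⇒< z p z<ᵇp
  inStrip⇒ {z} (fsuc fzero) h = (<⇒≢ p<z ∘ sym) , <⇒≢ z<q ,
                                sym (cong₂ stripOf (<ᵇ-false (<⇒≤ p<z)) (<ᵇ-true z<q))
    where
    p<z = <ᵇ⇒< p z (proj₁ (Equivalence.to (T-∧ {p <ᵇ z}) h))
    z<q = <ᵇ⇒< z q (proj₂ (Equivalence.to (T-∧ {p <ᵇ z}) h))
  inStrip⇒ {z} (fsuc (fsuc fzero)) h = (<⇒≢ (<-trans p<q q<z) ∘ sym) , (<⇒≢ q<z ∘ sym) ,
                                       sym (cong₂ stripOf (<ᵇ-false (<⇒≤ (<-trans p<q q<z))) (<ᵇ-false (<⇒≤ q<z)))
    where q<z = <ᵇ⇒< q z (proj₁ (Equivalence.to (T-∧ {q <ᵇ z}) h))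

  inStrip-strip : ∀ {z} → z < n → z ≢ p → z ≢ q → T (inStrip n p q (strip p q z) z)
  inStrip-strip {z} z<n z≢p z≢q with <-cmp z p
  ... | tri< z<p _ _ rewrite <ᵇ-true z<p = <⇒<ᵇ z<p
  ... | tri≈ _ z≡p _ = contradiction z≡p z≢p
  ... | tri> _ _ p<z with <-cmp z q
  ...   | tri< z<q _ _ rewrite <ᵇ-false (<⇒≤ p<z) | <ᵇ-true z<q = Equivalence.from T-∧ (<⇒<ᵇ p<z , <⇒<ᵇ z<q)
  ...   | tri≈ _ z≡q _ = contradiction z≡q z≢q
  ...   | tri> _ _ q<z rewrite <ᵇ-false (<⇒≤ p<z) | <ᵇ-false (<⇒≤ q<z) = Equivalence.from T-∧ (<⇒<ᵇ q<z , <⇒<ᵇ z<n)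

  𝟙-inStrip : ∀ {z} c → z < n → 𝟙 (inStrip n p q c z) ≡ 𝟙 (not (z ≡ᵇ p) ∧ not (z ≡ᵇ q)) * 𝟙 (c ≡ᶠ strip p q z)
  𝟙-inStrip {z} c z<n = trans (cong 𝟙 (T-ext (mk⇔ to from))) (𝟙-∧ (not (z ≡ᵇ p) ∧ not (z ≡ᵇ q)) _)
    where
    to : T (inStrip n p q c z) → T ((not (z ≡ᵇ p) ∧ not (z ≡ᵇ q)) ∧ (c ≡ᶠ strip p q z))
    to h = let z≢p , z≢q , c≡s = inStrip⇒ c h in
           Equivalence.from T-∧ (Equivalence.from T-∧ (Equivalence.from T-≢ᵇ z≢p , Equivalence.from T-≢ᵇ z≢q) ,
                                 Equivalence.from (≡ᶠ⇔≡ {i = c}) c≡s)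
    from : T ((not (z ≡ᵇ p) ∧ not (z ≡ᵇ q)) ∧ (c ≡ᶠ strip p q z)) → T (inStrip n p q c z)
    from h with Equivalence.to (T-∧ {not (z ≡ᵇ p) ∧ not (z ≡ᵇ q)}) h
    ... | ends , c≡ᶠs with Equivalence.to (T-∧ {not (z ≡ᵇ p)}) ends
    ...   | z≢ᵇp , z≢ᵇq rewrite Equivalence.to (≡ᶠ⇔≡ {i = c}) c≡ᶠs =
      inStrip-strip z<n (Equivalence.to T-≢ᵇ z≢ᵇp) (Equivalence.to T-≢ᵇ z≢ᵇq)

width : ℕ → ℕ → ℕ → Fin 3 → ℕ
width n p q fzero               = p
width n p q (fsuc fzero)        = q ∸ suc p
width n p q (fsuc (fsuc fzero)) = n ∸ suc q

∑<-inStrip : ∀ {n p q} → p < q → q < n → ∀ c → ∑[ z < n ] 𝟙 (inStrip n p q c z) ≡ width n p q c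
∑<-inStrip         p<q q<n fzero               = ∑<-below (<⇒≤ (<-trans p<q q<n))
∑<-inStrip {p = p} p<q q<n (fsuc fzero)        = ∑<-between p (<⇒≤ q<n)
∑<-inStrip {n} {q = q} p<q q<n (fsuc (fsuc fzero)) = ∑<-between {n} q ≤-refl

∑-width : ∀ {n p q} → p < q → q < n → ∑[ c ∈ allFin 3 ] width n p q c ≡ n ∸ 2
∑-width {p = p} p<q q<n with m≤n⇒∃[o]m+o≡n p<q
... | x , refl with m≤n⇒∃[o]m+o≡n q<n
...   | y , refl rewrite m+n∸m≡n p x | m+n∸m≡n (suc (p + x)) y | +-identityʳ y = sym (+-assoc p x y)

labelOf : Bool → Bool → Fin 3 → Fin 5
labelOf true  _     _ = fzero
labelOf false true  _ = fsuc fzero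
labelOf false false B = fsuc (fsuc B)

-- p gets label 0, q label 1, and a point of strip c label 2 + g c.
blockLabel : (Fin 3 → Fin 3) → ℕ → ℕ → ℕ → Fin 5
blockLabel g p q z = labelOf (z ≡ᵇ p) (z ≡ᵇ q) (g (strip p q z))

labelling : ∀ {n} → (Fin 3 → Fin 3) → ℕ → ℕ → Fin n → Fin 5
labelling g p q k = blockLabel g p q (toℕ k)

blockSize : (Fin 3 → Fin 3) → ℕ → ℕ → ℕ → Fin 3 → ℕ
blockSize g n p q B = ∑[ c ∈ allFin 3 ] 𝟙 (g c ≡ᶠ B) * width n p q c

∑-blockSize : ∀ (g : Fin 3 → Fin 3) n p q → ∑ (allFin 3) (blockSize g n p q) ≡ ∑ (allFin 3) (width n p q)
∑-blockSize g n p q = trans (∑-comm (allFin 3) (allFin 3) (λ B c → 𝟙 (g c ≡ᶠ B) * width n p q c))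
  (∑-cong (allFin 3) λ c → trans (∑-cong (allFin 3) λ B → cong (λ x → 𝟙 x * width n p q c) (≡ᵇ-comm (toℕ (g c)) (toℕ B)))
                                 (∑-allFin-point (g c) (λ _ → width n p q c)))

module _ (g : Fin 3 → Fin 3) (p q : ℕ) where

  blockLabel-first : blockLabel g p q p ≡ fzero
  blockLabel-first = cong (λ x → labelOf x (p ≡ᵇ q) (g (strip p q p))) (≡ᵇ-refl p)

  blockLabel-second : p ≢ q → blockLabel g p q q ≡ fsuc fzero
  blockLabel-second p≢q = cong₂ (λ x y → labelOf x y (g (strip p q q))) (≡ᵇ-≢ (p≢q ∘ sym)) (≡ᵇ-refl q)

  blockLabel-block : ∀ {z} → z ≢ p → z ≢ q → blockLabel g p q z ≡ fsuc (fsuc (g (strip p q z)))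
  blockLabel-block {z} z≢p z≢q = cong₂ (λ x y → labelOf x y (g (strip p q z))) (≡ᵇ-≢ z≢p) (≡ᵇ-≢ z≢q)

  blockLabel-first⁻ : ∀ {z} → blockLabel g p q z ≡ fzero → z ≡ p
  blockLabel-first⁻ {z} with z ≡ᵇ p in z≡ᵇp | z ≡ᵇ q
  ... | true  | _     = λ _ → ≡ᵇ⇒≡ z p (Equivalence.from T-≡ z≡ᵇp)
  ... | false | true  = λ ()
  ... | false | false = λ ()

  blockLabel-second⁻ : ∀ {z} → blockLabel g p q z ≡ fsuc fzero → z ≡ q
  blockLabel-second⁻ {z} with z ≡ᵇ p | z ≡ᵇ q in z≡ᵇq
  ... | true  | _     = λ ()
  ... | false | true  = λ _ → ≡ᵇ⇒≡ z q (Equivalence.from T-≡ z≡ᵇq)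
  ... | false | false = λ ()

module _ {n p q : ℕ} (g : Fin 3 → Fin 3) (p<q : p < q) (q<n : q < n) where

  private
    𝟙-labelOf-first : ∀ a b B → 𝟙 (labelOf a b B ≡ᶠ fzero) ≡ 𝟙 a * 1
    𝟙-labelOf-first true  _     _ = refl
    𝟙-labelOf-first false true  _ = refl
    𝟙-labelOf-first false false _ = refl

    𝟙-labelOf-second : ∀ a b B → ¬ (T a × T b) → 𝟙 (labelOf a b B ≡ᶠ fsuc fzero) ≡ 𝟙 b * 1
    𝟙-labelOf-second true  false _ _ = refl
    𝟙-labelOf-second true  true  _ ¬both = contradiction (tt , tt) ¬both
    𝟙-labelOf-second false true  _ _ = refl
    𝟙-labelOf-second false false _ _ = refl

    𝟙-labelOf-block : ∀ a b B B′ → 𝟙 (labelOf a b B ≡ᶠ fsuc (fsuc B′)) ≡ 𝟙 (not a ∧ not b) * 𝟙 (B ≡ᶠ B′)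
    𝟙-labelOf-block true  _     _ _ = refl
    𝟙-labelOf-block false true  _ _ = refl
    𝟙-labelOf-block false false B B′ = sym (+-identityʳ _)

  fibre-first : fibre (labelling {n} g p q) fzero ≡ 1
  fibre-first = begin
    ∑[ k ∈ allFin n ] 𝟙 (blockLabel g p q (toℕ k) ≡ᶠ fzero)   ≡⟨ ∑<-allFin n (λ z → 𝟙 (blockLabel g p q z ≡ᶠ fzero)) ⟩
    ∑[ z < n ] 𝟙 (blockLabel g p q z ≡ᶠ fzero)               ≡⟨ ∑<-cong n (λ z _ → 𝟙-labelOf-first (z ≡ᵇ p) (z ≡ᵇ q) _) ⟩
    ∑[ z < n ] 𝟙 (z ≡ᵇ p) * 1                                ≡⟨ ∑<-point (λ _ → 1) (<-trans p<q q<n) ⟩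
    1                                                         ∎
    where open ≡-Reasoning

  fibre-second : fibre (labelling {n} g p q) (fsuc fzero) ≡ 1
  fibre-second = begin
    ∑[ k ∈ allFin n ] 𝟙 (blockLabel g p q (toℕ k) ≡ᶠ fsuc fzero)   ≡⟨ ∑<-allFin n (λ z → 𝟙 (blockLabel g p q z ≡ᶠ fsuc fzero)) ⟩
    ∑[ z < n ] 𝟙 (blockLabel g p q z ≡ᶠ fsuc fzero)               ≡⟨ ∑<-cong n (λ z _ → 𝟙-labelOf-second (z ≡ᵇ p) (z ≡ᵇ q) _ (p≢q z)) ⟩
    ∑[ z < n ] 𝟙 (z ≡ᵇ q) * 1                                     ≡⟨ ∑<-point (λ _ → 1) q<n ⟩
    1                                                              ∎
    where
    open ≡-Reasoning
    p≢q : ∀ z → ¬ (T (z ≡ᵇ p) × T (z ≡ᵇ q))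
    p≢q z (z≡p , z≡q) = <⇒≢ p<q (trans (sym (≡ᵇ⇒≡ z p z≡p)) (≡ᵇ⇒≡ z q z≡q))

  fibre-block : ∀ B → fibre (labelling {n} g p q) (fsuc (fsuc B)) ≡ blockSize g n p q B
  fibre-block B = begin
    ∑[ k ∈ allFin n ] 𝟙 (blockLabel g p q (toℕ k) ≡ᶠ fsuc (fsuc B))
      ≡⟨ ∑<-allFin n (λ z → 𝟙 (blockLabel g p q z ≡ᶠ fsuc (fsuc B))) ⟩
    ∑[ z < n ] 𝟙 (blockLabel g p q z ≡ᶠ fsuc (fsuc B))
      ≡⟨ ∑<-cong n (λ z z<n → trans (𝟙-labelOf-block (z ≡ᵇ p) (z ≡ᵇ q) _ B) (𝟙-off-ends z z<n)) ⟩
    ∑[ z < n ] ∑[ c ∈ allFin 3 ] 𝟙 (g c ≡ᶠ B) * 𝟙 (inStrip n p q c z)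
      ≡⟨ ∑<-allFin n (λ z → ∑[ c ∈ allFin 3 ] 𝟙 (g c ≡ᶠ B) * 𝟙 (inStrip n p q c z)) ⟨
    ∑[ k ∈ allFin n ] ∑[ c ∈ allFin 3 ] 𝟙 (g c ≡ᶠ B) * 𝟙 (inStrip n p q c (toℕ k))
      ≡⟨ ∑-comm (allFin n) (allFin 3) (λ k c → 𝟙 (g c ≡ᶠ B) * 𝟙 (inStrip n p q c (toℕ k))) ⟩
    ∑[ c ∈ allFin 3 ] ∑[ k ∈ allFin n ] 𝟙 (g c ≡ᶠ B) * 𝟙 (inStrip n p q c (toℕ k))
      ≡⟨ ∑-cong (allFin 3) (λ c → trans (sym (*-distribˡ-∑ (𝟙 (g c ≡ᶠ B)) (allFin n) (λ k → 𝟙 (inStrip n p q c (toℕ k)))))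
                                        (cong (𝟙 (g c ≡ᶠ B) *_)
           (trans (∑<-allFin n (λ z → 𝟙 (inStrip n p q c z))) (∑<-inStrip p<q q<n c)))) ⟩
    blockSize g n p q B ∎
    where
    open ≡-Reasoning
    𝟙-off-ends : ∀ z → z < n → 𝟙 (not (z ≡ᵇ p) ∧ not (z ≡ᵇ q)) * 𝟙 (g (strip p q z) ≡ᶠ B)
                              ≡ ∑[ c ∈ allFin 3 ] 𝟙 (g c ≡ᶠ B) * 𝟙 (inStrip n p q c z)
    𝟙-off-ends z z<n = begin
      e * 𝟙 (g (strip p q z) ≡ᶠ B)                                 ≡⟨ cong (e *_) (∑-allFin-point (strip p q z) (λ c → 𝟙 (g c ≡ᶠ B))) ⟨
      e * (∑[ c ∈ allFin 3 ] 𝟙 (c ≡ᶠ strip p q z) * 𝟙 (g c ≡ᶠ B))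
        ≡⟨ *-distribˡ-∑ e (allFin 3) (λ c → 𝟙 (c ≡ᶠ strip p q z) * 𝟙 (g c ≡ᶠ B)) ⟩
      ∑[ c ∈ allFin 3 ] e * (𝟙 (c ≡ᶠ strip p q z) * 𝟙 (g c ≡ᶠ B))   ≡⟨ ∑-cong (allFin 3) (λ c → rearrange c) ⟩
      ∑[ c ∈ allFin 3 ] 𝟙 (g c ≡ᶠ B) * 𝟙 (inStrip n p q c z)        ∎
      where
      e = 𝟙 (not (z ≡ᵇ p) ∧ not (z ≡ᵇ q))
      rearrange : ∀ c → e * (𝟙 (c ≡ᶠ strip p q z) * 𝟙 (g c ≡ᶠ B)) ≡ 𝟙 (g c ≡ᶠ B) * 𝟙 (inStrip n p q c z)
      rearrange c = trans (sym (*-assoc e a b)) (trans (*-comm (e * a) b) (cong (b *_) (sym (𝟙-inStrip p<q c z<n))))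
        where
        a = 𝟙 (c ≡ᶠ strip p q z)
        b = 𝟙 (g c ≡ᶠ B)

Increasing : ℕ → ℕ → ℕ → Set
Increasing n p q = p < q × q < n

record Blocks : Set where
  constructor blocks
  field
    col row : Fin 3 → Fin 3

open Blocks

HasBlocks : MeshR → Blocks → Set
HasBlocks R D = ∀ c r → ((c , r) ∉ R) ⇔ (col D c ≡ row D r)

balanced : Blocks → ℕ → ℕ → ℕ → ℕ → ℕ → Bool
balanced D n u₁ u₂ a b = all (λ B → blockSize (row D) n a b B ≡ᵇ blockSize (col D) n u₁ u₂ B) (allFin 3)

weight : Blocks → ℕ → ℕ → ℕ → ℕ
weight D n u₁ u₂ = ∏[ B ∈ allFin 3 ] blockSize (col D) n u₁ u₂ B !

-- The number of pairs (π ∈ S_n, occurrence in π) of any pattern with blocks D, see ∑-occ.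
occurrences : Blocks → ℕ → ℕ
occurrences D n = ∑[ u₁ < n ] ∑[ u₂ < n ] ∑[ a < n ] ∑[ b < n ]
  𝟙 (((u₁ <ᵇ u₂) ∧ (a <ᵇ b)) ∧ balanced D n u₁ u₂ a b) * weight D n u₁ u₂

fibres-product : ∀ D {n u₁ u₂ a b} → u₁ < u₂ → u₂ < n → a < b → b < n →
  ∏[ G ∈ allFin 5 ] (fibre (labelling {n} (row D) a b) G P′ fibre (labelling {n} (col D) u₁ u₂) G)
  ≡ 𝟙 (balanced D n u₁ u₂ a b) * weight D n u₁ u₂
fibres-product D {n} {u₁} {u₂} {a} {b} u₁<u₂ u₂<n a<b b<n = begin
    ∏[ G ∈ allFin 5 ] (fibre (labelling {n} (row D) a b) G P′ fibre (labelling {n} (col D) u₁ u₂) G)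
      ≡⟨ cong₂ _*_ (cong₂ _P′_ (fibre-first (row D) a<b b<n) (fibre-first (col D) u₁<u₂ u₂<n))
           (cong₂ _*_ (cong₂ _P′_ (fibre-second (row D) a<b b<n) (fibre-second (col D) u₁<u₂ u₂<n))
             (∏-cong (allFin 3) λ B → cong₂ _P′_ (fibre-block (row D) a<b b<n B) (fibre-block (col D) u₁<u₂ u₂<n B))) ⟩
    1 * (1 * (∏[ B ∈ allFin 3 ] (blockSize (row D) n a b B P′ blockSize (col D) n u₁ u₂ B)))
      ≡⟨ trans (*-identityˡ _) (*-identityˡ _) ⟩
    ∏[ B ∈ allFin 3 ] (blockSize (row D) n a b B P′ blockSize (col D) n u₁ u₂ B)
      ≡⟨ ∏-P′ (blockSize (row D) n a b) (blockSize (col D) n u₁ u₂) (allFin 3) (≤-reflexive same-total) ⟩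
    𝟙 (balanced D n u₁ u₂ a b) * weight D n u₁ u₂ ∎
    where
    open ≡-Reasoning
    same-total : ∑ (allFin 3) (blockSize (row D) n a b) ≡ ∑ (allFin 3) (blockSize (col D) n u₁ u₂)
    same-total = trans (∑-blockSize (row D) n a b) (trans (∑-width a<b b<n)
                   (sym (trans (∑-blockSize (col D) n u₁ u₂) (∑-width u₁<u₂ u₂<n))))

-- The two ⇔ hypotheses say that (u₁ , a), (u₂ , b), (v₁ , c) and (v₂ , d) are points of one permutation.
Rigid : Blocks → ℕ → Set
Rigid D n = ∀ {u₁ u₂ a b v₁ v₂ c d} → Increasing n u₁ u₂ → Increasing n a b → Increasing n v₁ v₂ → Increasing n c d →
  T (balanced D n u₁ u₂ a b) → T (balanced D n v₁ v₂ c d) → (u₁ ≡ v₁ ⇔ a ≡ c) → (u₂ ≡ v₂ ⇔ b ≡ d) → u₁ ≡ v₁ × u₂ ≡ v₂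

module _ {n : ℕ} (R : MeshR) (π : Word n) (i₁ i₂ : Fin n) where

  Avoids : Set
  Avoids = ∀ {c r} → (c , r) ∈ R → ∀ k →
    ¬ (T (inStrip n (toℕ i₁) (toℕ i₂) c (toℕ k)) × T (inStrip n (toℕ (lookup π i₁)) (toℕ (lookup π i₂)) r (toℕ (lookup π k))))

  isOcc⇔ : T (isOcc R π i₁ i₂) ⇔ (T (toℕ i₁ <ᵇ toℕ i₂) × T (toℕ (lookup π i₁) <ᵇ toℕ (lookup π i₂)) × Avoids)
  isOcc⇔ = ⇔.trans T-∧ (⇔.refl ×-⇔ ⇔.trans T-∧ (⇔.refl ×-⇔ mk⇔ to from))
    where
    left : Fin 3 → Fin n → Bool
    left c k = bnd 0 (suc (toℕ i₁)) (suc (toℕ i₂)) (suc n) (F.inject₁ c) <ᵇ suc (toℕ k)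
    to : T (all _ R) → Avoids
    to h {c} cr∈R k (in₁ , in₂) = Equivalence.to T-not (Equivalence.to (T-all-allFin _) (Equivalence.to (T-all _ R) h cr∈R) k)
      (subst T (∧-assoc (left c k) _ _) (Equivalence.from T-∧ (in₁ , in₂)))
    from : Avoids → T (all _ R)
    from avoids = Equivalence.from (T-all _ R) λ { {c , r} cr∈R → Equivalence.from (T-all-allFin _) λ k →
      Equivalence.from T-not λ h → avoids cr∈R k (Equivalence.to T-∧ (subst T (sym (∧-assoc (left c k) _ _)) h)) }

module _ {R : MeshR} {D : Blocks} (R-blocks : HasBlocks R D) {n : ℕ} (π : Word n) (i₁ i₂ : Fin n) (a b : ℕ) where

  private
    u₁ = toℕ i₁
    u₂ = toℕ i₂
    positionLabel valueLabel : Fin n → Fin 5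
    positionLabel = labelling (col D) u₁ u₂
    valueLabel    = labelling (row D) a b

  occurrence⇒respects : Injective _≡_ _≡_ (lookup π) → toℕ (lookup π i₁) ≡ a → toℕ (lookup π i₂) ≡ b →
                        T (isOcc R π i₁ i₂) → ∀ k → valueLabel (lookup π k) ≡ positionLabel k
  occurrence⇒respects inj refl refl occurs k with Equivalence.to (isOcc⇔ R π i₁ i₂) occurs | k F.≟ i₁ | k F.≟ i₂
  ... | _ , _ , _ | yes refl | _ = trans (blockLabel-first (row D) a b) (sym (blockLabel-first (col D) u₁ u₂))
  ... | u₁<ᵇu₂ , a<ᵇb , _ | no _ | yes refl =
    trans (blockLabel-second (row D) a b (<⇒≢ (<ᵇ⇒< a b a<ᵇb))) (sym (blockLabel-second (col D) u₁ u₂ (<⇒≢ (<ᵇ⇒< u₁ u₂ u₁<ᵇu₂))))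
  ... | u₁<ᵇu₂ , a<ᵇb , avoids | no k≢i₁ | no k≢i₂ = begin
    valueLabel (lookup π k)                    ≡⟨ blockLabel-block (row D) a b (≢-value k≢i₁) (≢-value k≢i₂) ⟩
    fsuc (fsuc (row D (strip a b πk)))         ≡⟨ cong (fsuc ∘ fsuc) (sym same-block) ⟩
    fsuc (fsuc (col D (strip u₁ u₂ (toℕ k)))) ≡⟨ blockLabel-block (col D) u₁ u₂ (k≢i₁ ∘ toℕ-injective) (k≢i₂ ∘ toℕ-injective) ⟨
    positionLabel k                            ∎
    where
    open ≡-Reasoning
    πk = toℕ (lookup π k)
    ≢-value : ∀ {i} → k ≢ i → πk ≢ toℕ (lookup π i)
    ≢-value k≢i = k≢i ∘ inj ∘ toℕ-injective
    same-block : col D (strip u₁ u₂ (toℕ k)) ≡ row D (strip a b πk)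
    same-block = Equivalence.to (R-blocks _ _) λ cell∈R → avoids cell∈R k
      ( inStrip-strip (<ᵇ⇒< u₁ u₂ u₁<ᵇu₂) (toℕ<n k) (k≢i₁ ∘ toℕ-injective) (k≢i₂ ∘ toℕ-injective)
      , inStrip-strip (<ᵇ⇒< a b a<ᵇb) (toℕ<n (lookup π k)) (≢-value k≢i₁) (≢-value k≢i₂))

  respects⇒occurrence : u₁ < u₂ → a < b → (∀ k → valueLabel (lookup π k) ≡ positionLabel k) →
                        toℕ (lookup π i₁) ≡ a × toℕ (lookup π i₂) ≡ b × T (isOcc R π i₁ i₂)
  respects⇒occurrence u₁<u₂ a<b agree = πi₁≡a , πi₂≡b ,
    Equivalence.from (isOcc⇔ R π i₁ i₂) (<⇒<ᵇ u₁<u₂ , <⇒<ᵇ (subst₂ _<_ (sym πi₁≡a) (sym πi₂≡b) a<b) , avoids)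
    where
    πi₁≡a = blockLabel-first⁻ (row D) a b (trans (agree i₁) (blockLabel-first (col D) u₁ u₂))
    πi₂≡b = blockLabel-second⁻ (row D) a b (trans (agree i₂) (blockLabel-second (col D) u₁ u₂ (<⇒≢ u₁<u₂)))
    avoids : Avoids R π i₁ i₂
    avoids {c} {r} cr∈R k (in-c , in-r) = Equivalence.from (R-blocks c r) col≡row cr∈R
      where
      position = inStrip⇒ u₁<u₂ c in-c
      value = inStrip⇒ a<b r (subst₂ (λ x y → T (inStrip n x y r (toℕ (lookup π k)))) πi₁≡a πi₂≡b in-r)
      col≡row : col D c ≡ row D r
      col≡row = begin
        col D c                                    ≡⟨ cong (col D) (proj₂ (proj₂ position)) ⟩
        col D (strip u₁ u₂ (toℕ k))                ≡⟨ fsuc-injective (fsuc-injective (begin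
          fsuc (fsuc (col D (strip u₁ u₂ (toℕ k))))     ≡⟨ blockLabel-block (col D) u₁ u₂ (proj₁ position) (proj₁ (proj₂ position)) ⟨
          positionLabel k                                ≡⟨ agree k ⟨
          valueLabel (lookup π k)                        ≡⟨ blockLabel-block (row D) a b (proj₁ value) (proj₁ (proj₂ value)) ⟩
          fsuc (fsuc (row D (strip a b (toℕ (lookup π k))))) ∎)) ⟩
        row D (strip a b (toℕ (lookup π k)))       ≡⟨ cong (row D) (proj₂ (proj₂ value)) ⟨
        row D r                                    ∎
        where open ≡-Reasoning

  occurrence⇔respects : Injective _≡_ _≡_ (lookup π) →
    (toℕ (lookup π i₁) ≡ a × toℕ (lookup π i₂) ≡ b × T (isOcc R π i₁ i₂)) ⇔
    (T ((u₁ <ᵇ u₂) ∧ (a <ᵇ b)) × T (respects valueLabel positionLabel π))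
  occurrence⇔respects inj = mk⇔
    (λ (πi₁≡a , πi₂≡b , occurs) → let u₁<ᵇu₂ , a<ᵇb , _ = Equivalence.to (isOcc⇔ R π i₁ i₂) occurs in
       Equivalence.from T-∧ (u₁<ᵇu₂ , subst₂ (λ x y → T (x <ᵇ y)) πi₁≡a πi₂≡b a<ᵇb) ,
       Equivalence.from (respects⇔ valueLabel positionLabel π) (occurrence⇒respects inj πi₁≡a πi₂≡b occurs))
    (λ (ordered , resp) → let u₁<ᵇu₂ , a<ᵇb = Equivalence.to (T-∧ {u₁ <ᵇ u₂}) ordered in
       respects⇒occurrence (<ᵇ⇒< u₁ u₂ u₁<ᵇu₂) (<ᵇ⇒< a b a<ᵇb) (Equivalence.to (respects⇔ valueLabel positionLabel π) resp))

occ≡∑ : ∀ {n} (R : MeshR) (π : Word n) → occ R π ≡ ∑[ i ∈ allFin n ] ∑[ j ∈ allFin n ] 𝟙 (isOcc R π i j)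
occ≡∑ {n} R π = trans (length-filterᵇ _ pairs)
  (trans (∑-concatMap (λ i → map (i ,_) (allFin n)) (allFin n) _) (∑-cong (allFin n) λ i → ∑-map (i ,_) (allFin n) _))
  where pairs = concatMap (λ i → map (i ,_) (allFin n)) (allFin n)

module _ {R : MeshR} {D : Blocks} (R-blocks : HasBlocks R D) {n : ℕ} where

  occurrence-by-values : (i₁ i₂ : Fin n) (π : Word n) → 𝟙 (distinct π ∧ isOcc R π i₁ i₂) ≡
    ∑[ a < n ] ∑[ b < n ] 𝟙 ((toℕ i₁ <ᵇ toℕ i₂) ∧ (a <ᵇ b)) *
                          𝟙 (distinct π ∧ respects (labelling (row D) a b) (labelling (col D) (toℕ i₁) (toℕ i₂)) π)
  occurrence-by-values i₁ i₂ π = begin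
    𝟙 (distinct π ∧ occurs)
      ≡⟨ ∑<-point (λ _ → 𝟙 (distinct π ∧ occurs)) (toℕ<n (lookup π i₂)) ⟨
    ∑[ b < n ] 𝟙 (b ≡ᵇ y) * 𝟙 (distinct π ∧ occurs)
      ≡⟨ ∑<-point (λ _ → ∑[ b < n ] 𝟙 (b ≡ᵇ y) * 𝟙 (distinct π ∧ occurs)) (toℕ<n (lookup π i₁)) ⟨
    ∑[ a < n ] 𝟙 (a ≡ᵇ x) * (∑[ b < n ] 𝟙 (b ≡ᵇ y) * 𝟙 (distinct π ∧ occurs))
      ≡⟨ ∑<-cong n (λ a _ → *-distribˡ-∑< n (𝟙 (a ≡ᵇ x)) _) ⟩
    ∑[ a < n ] ∑[ b < n ] 𝟙 (a ≡ᵇ x) * (𝟙 (b ≡ᵇ y) * 𝟙 (distinct π ∧ occurs))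
      ≡⟨ ∑<-cong n (λ a _ → ∑<-cong n λ b _ → 𝟙-⇔ (a ≡ᵇ x) (b ≡ᵇ y) (distinct π) occurs _ _ λ d →
           ⇔.trans (≡ᵇ⇔ a x ×-⇔ ≡ᵇ⇔ b y ×-⇔ ⇔.refl)
                   (occurrence⇔respects R-blocks π i₁ i₂ a b (Equivalence.to (distinct⇔injective π) d))) ⟩
    ∑[ a < n ] ∑[ b < n ] 𝟙 ((toℕ i₁ <ᵇ toℕ i₂) ∧ (a <ᵇ b)) *
                          𝟙 (distinct π ∧ respects (labelling (row D) a b) (labelling (col D) (toℕ i₁) (toℕ i₂)) π) ∎
    where
    open ≡-Reasoning
    occurs = isOcc R π i₁ i₂
    x = toℕ (lookup π i₁)
    y = toℕ (lookup π i₂)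
    ≡ᵇ⇔ : ∀ m k → T (m ≡ᵇ k) ⇔ (k ≡ m)
    ≡ᵇ⇔ m k = mk⇔ (sym ∘ ≡ᵇ⇒≡ m k) (≡⇒≡ᵇ m k ∘ sym)

  count-occurrences-at : (i₁ i₂ : Fin n) →
    ∑[ π ∈ allVecs n n ] 𝟙 (distinct π ∧ isOcc R π i₁ i₂) ≡
    ∑[ a < n ] ∑[ b < n ] 𝟙 (((toℕ i₁ <ᵇ toℕ i₂) ∧ (a <ᵇ b)) ∧ balanced D n (toℕ i₁) (toℕ i₂) a b) * weight D n (toℕ i₁) (toℕ i₂)
  count-occurrences-at i₁ i₂ = begin
    ∑[ π ∈ allVecs n n ] 𝟙 (distinct π ∧ isOcc R π i₁ i₂)
      ≡⟨ ∑-cong (allVecs n n) (occurrence-by-values i₁ i₂) ⟩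
    ∑[ π ∈ allVecs n n ] ∑[ a < n ] ∑[ b < n ] 𝟙 (C a b) * 𝟙 (distinct π ∧ respects (ρ a b) κ π)
      ≡⟨ ∑-∑<-comm (allVecs n n) n _ ⟩
    ∑[ a < n ] ∑[ π ∈ allVecs n n ] ∑[ b < n ] 𝟙 (C a b) * 𝟙 (distinct π ∧ respects (ρ a b) κ π)
      ≡⟨ ∑<-cong n (λ a _ → ∑-∑<-comm (allVecs n n) n _) ⟩
    ∑[ a < n ] ∑[ b < n ] ∑[ π ∈ allVecs n n ] 𝟙 (C a b) * 𝟙 (distinct π ∧ respects (ρ a b) κ π)
      ≡⟨ ∑<-cong n (λ a _ → ∑<-cong n λ b _ → sym (*-distribˡ-∑ (𝟙 (C a b)) (allVecs n n) _)) ⟩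
    ∑[ a < n ] ∑[ b < n ] 𝟙 (C a b) * (∑[ π ∈ allVecs n n ] 𝟙 (distinct π ∧ respects (ρ a b) κ π))
      ≡⟨ ∑<-cong n (λ a _ → ∑<-cong n λ b _ → cong (𝟙 (C a b) *_) (count-injective-respecting (ρ a b) n κ)) ⟩
    ∑[ a < n ] ∑[ b < n ] 𝟙 (C a b) * (∏[ G ∈ allFin 5 ] (fibre (ρ a b) G P′ fibre κ G))
      ≡⟨ ∑<-cong n (λ a _ → ∑<-cong n λ b b<n → trans (𝟙-guard (C a b) λ c →
           let u₁<ᵇu₂ , a<ᵇb = Equivalence.to (T-∧ {u₁ <ᵇ u₂}) c in
           fibres-product D (<ᵇ⇒< u₁ u₂ u₁<ᵇu₂) (toℕ<n i₂) (<ᵇ⇒< a b a<ᵇb) b<n)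
           (𝟙-∧-* (C a b) _ _)) ⟩
    ∑[ a < n ] ∑[ b < n ] 𝟙 (C a b ∧ balanced D n u₁ u₂ a b) * weight D n u₁ u₂ ∎
    where
    open ≡-Reasoning
    u₁ = toℕ i₁
    u₂ = toℕ i₂
    C : ℕ → ℕ → Bool
    C a b = (u₁ <ᵇ u₂) ∧ (a <ᵇ b)
    ρ : ℕ → ℕ → Fin n → Fin 5
    ρ = labelling (row D)
    κ : Fin n → Fin 5
    κ = labelling (col D) u₁ u₂

  ∑-occ : ∑[ π ∈ allVecs n n ] 𝟙 (distinct π) * occ R π ≡ occurrences D n
  ∑-occ = begin
    ∑[ π ∈ allVecs n n ] 𝟙 (distinct π) * occ R π
      ≡⟨ ∑-cong (allVecs n n) distribute ⟩
    ∑[ π ∈ allVecs n n ] ∑[ i ∈ allFin n ] ∑[ j ∈ allFin n ] 𝟙 (distinct π ∧ isOcc R π i j)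
      ≡⟨ ∑-comm (allVecs n n) (allFin n) _ ⟩
    ∑[ i ∈ allFin n ] ∑[ π ∈ allVecs n n ] ∑[ j ∈ allFin n ] 𝟙 (distinct π ∧ isOcc R π i j)
      ≡⟨ ∑-cong (allFin n) (λ i → ∑-comm (allVecs n n) (allFin n) _) ⟩
    ∑[ i ∈ allFin n ] ∑[ j ∈ allFin n ] ∑[ π ∈ allVecs n n ] 𝟙 (distinct π ∧ isOcc R π i j)
      ≡⟨ ∑-cong (allFin n) (λ i → ∑-cong (allFin n) λ j → count-occurrences-at i j) ⟩
    ∑[ i ∈ allFin n ] ∑[ j ∈ allFin n ] F (toℕ i) (toℕ j)
      ≡⟨ ∑-cong (allFin n) (λ i → ∑<-allFin n (F (toℕ i))) ⟩
    ∑[ i ∈ allFin n ] ∑[ u₂ < n ] F (toℕ i) u₂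
      ≡⟨ ∑<-allFin n (λ u₁ → ∑[ u₂ < n ] F u₁ u₂) ⟩
    occurrences D n ∎
    where
    open ≡-Reasoning
    F : ℕ → ℕ → ℕ
    F u₁ u₂ = ∑[ a < n ] ∑[ b < n ] 𝟙 (((u₁ <ᵇ u₂) ∧ (a <ᵇ b)) ∧ balanced D n u₁ u₂ a b) * weight D n u₁ u₂
    distribute : ∀ π → 𝟙 (distinct π) * occ R π ≡ ∑[ i ∈ allFin n ] ∑[ j ∈ allFin n ] 𝟙 (distinct π ∧ isOcc R π i j)
    distribute π = trans (cong (𝟙 (distinct π) *_) (occ≡∑ R π)) (trans (*-distribˡ-∑ (𝟙 (distinct π)) (allFin n) _)
      (∑-cong (allFin n) λ i → trans (*-distribˡ-∑ (𝟙 (distinct π)) (allFin n) _)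
                                     (∑-cong (allFin n) λ j → sym (𝟙-∧ (distinct π) (isOcc R π i j)))))

  occurrence⇒balanced : ∀ {π : Word n} {i₁ i₂} → T (distinct π) → T (isOcc R π i₁ i₂) →
    toℕ i₁ < toℕ i₂ × toℕ (lookup π i₁) < toℕ (lookup π i₂) ×
    T (balanced D n (toℕ i₁) (toℕ i₂) (toℕ (lookup π i₁)) (toℕ (lookup π i₂)))
  occurrence⇒balanced {π} {i₁} {i₂} d occurs = u₁<u₂ , a<b , 𝟙≥1⇒T (≤-trans counted (≤-reflexive count))
    where
    a = toℕ (lookup π i₁)
    b = toℕ (lookup π i₂)
    u₁ = toℕ i₁
    u₂ = toℕ i₂
    ordered = Equivalence.to (isOcc⇔ R π i₁ i₂) occurs
    u₁<u₂ = <ᵇ⇒< u₁ u₂ (proj₁ ordered)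
    a<b = <ᵇ⇒< a b (proj₁ (proj₂ ordered))
    respected = proj₂ (Equivalence.to (occurrence⇔respects R-blocks π i₁ i₂ a b (Equivalence.to (distinct⇔injective π) d)) (refl , refl , occurs))
    counted : 1 ≤ ∑[ v ∈ allVecs n n ] 𝟙 (distinct v ∧ respects (labelling (row D) a b) (labelling (col D) u₁ u₂) v)
    counted = ∑-member (∈-allVecs π) (≤-reflexive (cong 𝟙 (sym (Equivalence.to T-≡ (Equivalence.from T-∧ (d , respected))))))
    count : ∑[ v ∈ allVecs n n ] 𝟙 (distinct v ∧ respects (labelling (row D) a b) (labelling (col D) u₁ u₂) v)
            ≡ 𝟙 (balanced D n u₁ u₂ a b) * weight D n u₁ u₂
    count = trans (count-injective-respecting (labelling (row D) a b) n (labelling (col D) u₁ u₂))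
                  (fibres-product D u₁<u₂ (toℕ<n i₂) a<b (toℕ<n (lookup π i₂)))
    𝟙≥1⇒T : ∀ {x m} → 1 ≤ 𝟙 x * m → T x
    𝟙≥1⇒T {true} _ = tt

  occ≤1 : Rigid D n → ∀ π → T (distinct π) → occ R π ≤ 1
  occ≤1 rigid π d = length-filterᵇ≤1 _ pairs unique-pairs λ { {i , j} {i′ , j′} → same i j i′ j′ }
    where
    pairs = concatMap (λ i → map (i ,_) (allFin n)) (allFin n)
    unique-pairs : Unique pairs
    unique-pairs = subst Unique (sym (concatMap≡cartesianProduct (allFin n) (allFin n))) (cartesianProduct⁺ (allFin⁺ n) (allFin⁺ n))
    inj = Equivalence.to (distinct⇔injective π) d
    link : ∀ i i′ → (toℕ i ≡ toℕ i′) ⇔ (toℕ (lookup π i) ≡ toℕ (lookup π i′))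
    link i i′ = mk⇔ (cong (toℕ ∘ lookup π) ∘ toℕ-injective) (cong toℕ ∘ inj ∘ toℕ-injective)
    same : ∀ i j i′ j′ → T (isOcc R π i j) → T (isOcc R π i′ j′) → (i , j) ≡ (i′ , j′)
    same i j i′ j′ occurs occurs′ with occurrence⇒balanced {π} {i} {j} d occurs | occurrence⇒balanced {π} {i′} {j′} d occurs′
    ... | i<j , πi<πj , bal | i′<j′ , πi′<πj′ , bal′ =
      let i≡i′ , j≡j′ = rigid (i<j , toℕ<n j) (πi<πj , toℕ<n (lookup π j)) (i′<j′ , toℕ<n j′) (πi′<πj′ , toℕ<n (lookup π j′))
                              bal bal′ (link i i′) (link j j′)
      in cong₂ _,_ (toℕ-injective i≡i′) (toℕ-injective j≡j′)

module _ {R : MeshR} {n : ℕ} (at-most-once : ∀ (π : Word n) → T (distinct π) → occ R π ≤ 1) where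

  private
    s≡∑ : ∀ k → s n k R ≡ ∑[ π ∈ allVecs n n ] 𝟙 (distinct π) * 𝟙 (occ R π ≡ᵇ k)
    s≡∑ k = trans (length-filterᵇ _ (filterᵇ isInjective (allVecs n n)))
                  (trans (∑-filterᵇ isInjective (allVecs n n) _)
                         (∑-cong (allVecs n n) λ π → cong (λ x → 𝟙 x * 𝟙 (occ R π ≡ᵇ k)) (isInjective≡distinct π)))

  s-one : s n 1 R ≡ ∑[ π ∈ allVecs n n ] 𝟙 (distinct π) * occ R π
  s-one = trans (s≡∑ 1) (∑-cong (allVecs n n) λ π → 𝟙-guard (distinct π) λ d → 𝟙≡ᵇ1 (at-most-once π d))
    where
    𝟙≡ᵇ1 : ∀ {m} → m ≤ 1 → 𝟙 (m ≡ᵇ 1) ≡ m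
    𝟙≡ᵇ1 z≤n       = refl
    𝟙≡ᵇ1 (s≤s z≤n) = refl

  s-zero : s n 0 R ≡ n ! ∸ s n 1 R
  s-zero = sym (trans (cong (_∸ s n 1 R) (sym total)) (m+n∸n≡m (s n 0 R) (s n 1 R)))
    where
    𝟙≡ᵇ0+𝟙≡ᵇ1 : ∀ {m} → m ≤ 1 → 𝟙 (m ≡ᵇ 0) + 𝟙 (m ≡ᵇ 1) ≡ 1
    𝟙≡ᵇ0+𝟙≡ᵇ1 z≤n       = refl
    𝟙≡ᵇ0+𝟙≡ᵇ1 (s≤s z≤n) = refl
    total : s n 0 R + s n 1 R ≡ n !
    total = begin
      s n 0 R + s n 1 R
        ≡⟨ cong₂ _+_ (s≡∑ 0) (s≡∑ 1) ⟩
      (∑[ π ∈ allVecs n n ] 𝟙 (distinct π) * 𝟙 (occ R π ≡ᵇ 0)) + (∑[ π ∈ allVecs n n ] 𝟙 (distinct π) * 𝟙 (occ R π ≡ᵇ 1))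
        ≡⟨ ∑-distrib-+ (allVecs n n) ⟨
      ∑[ π ∈ allVecs n n ] (𝟙 (distinct π) * 𝟙 (occ R π ≡ᵇ 0) + 𝟙 (distinct π) * 𝟙 (occ R π ≡ᵇ 1))
        ≡⟨ ∑-cong (allVecs n n) (λ π → trans (sym (*-distribˡ-+ (𝟙 (distinct π)) _ _))
             (trans (𝟙-guard (distinct π) (λ d → 𝟙≡ᵇ0+𝟙≡ᵇ1 (at-most-once π d))) (*-identityʳ (𝟙 (distinct π))))) ⟩
      ∑[ π ∈ allVecs n n ] 𝟙 (distinct π)
        ≡⟨ count-permutations n ⟩
      n ! ∎
      where open ≡-Reasoning

  s-many : ∀ k → 2 ≤ k → s n k R ≡ 0
  s-many k 2≤k = trans (s≡∑ k) (∑-zero (allVecs n n) λ π →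
    trans (𝟙-guard (distinct π) (λ d → cong 𝟙 (≡ᵇ-≢ (<⇒≢ (≤-<-trans (at-most-once π d) 2≤k))))) (*-zeroʳ (𝟙 (distinct π))))

distribution : ∀ {R D} → HasBlocks R D → (∀ {n} → Rigid D n) → (∀ n → occurrences D n ≡ A n) →
  ∀ n → (s n 0 R ≡ n ! ∸ A n) × (s n 1 R ≡ A n) × (∀ k → 2 ≤ k → s n k R ≡ 0)
distribution {R} R-blocks rigid count n =
  trans (s-zero {R} {n} at-most-once) (cong (n ! ∸_) s₁) , s₁ , s-many {R} {n} at-most-once
  where
  at-most-once : ∀ π → T (distinct π) → occ R π ≤ 1
  at-most-once = occ≤1 R-blocks rigid
  s₁ : s n 1 R ≡ A n
  s₁ = trans (s-one {R} {n} at-most-once) (trans (∑-occ R-blocks {n}) (count n))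

-- Symmetries of the blocks

transpose rotate : Blocks → Blocks
transpose D = blocks (row D) (col D)
rotate    D = blocks (col D ∘ opposite) (row D ∘ opposite)

all-cong : {p q : X → Bool} (xs : List X) → (∀ x → p x ≡ q x) → all p xs ≡ all q xs
all-cong []       _   = refl
all-cong (x ∷ xs) p≗q = cong₂ _∧_ (p≗q x) (all-cong xs p≗q)

∑<-swap-pairs : ∀ n (F : ℕ → ℕ → ℕ → ℕ → ℕ) →
  ∑[ x₁ < n ] ∑[ x₂ < n ] ∑[ y₁ < n ] ∑[ y₂ < n ] F x₁ x₂ y₁ y₂
  ≡ ∑[ y₁ < n ] ∑[ y₂ < n ] ∑[ x₁ < n ] ∑[ x₂ < n ] F x₁ x₂ y₁ y₂
∑<-swap-pairs n F = begin
  ∑[ x₁ < n ] ∑[ x₂ < n ] ∑[ y₁ < n ] ∑[ y₂ < n ] F x₁ x₂ y₁ y₂ ≡⟨ ∑<-cong n (λ x₁ _ → ∑<-comm n n _) ⟩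
  ∑[ x₁ < n ] ∑[ y₁ < n ] ∑[ x₂ < n ] ∑[ y₂ < n ] F x₁ x₂ y₁ y₂ ≡⟨ ∑<-comm n n _ ⟩
  ∑[ y₁ < n ] ∑[ x₁ < n ] ∑[ x₂ < n ] ∑[ y₂ < n ] F x₁ x₂ y₁ y₂ ≡⟨ ∑<-cong n (λ y₁ _ → ∑<-cong n λ x₁ _ → ∑<-comm n n _) ⟩
  ∑[ y₁ < n ] ∑[ x₁ < n ] ∑[ y₂ < n ] ∑[ x₂ < n ] F x₁ x₂ y₁ y₂ ≡⟨ ∑<-cong n (λ y₁ _ → ∑<-comm n n _) ⟩
  ∑[ y₁ < n ] ∑[ y₂ < n ] ∑[ x₁ < n ] ∑[ x₂ < n ] F x₁ x₂ y₁ y₂ ∎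
  where open ≡-Reasoning

module _ (D : Blocks) (n : ℕ) where

  balanced-transpose : ∀ u₁ u₂ a b → balanced (transpose D) n u₁ u₂ a b ≡ balanced D n a b u₁ u₂
  balanced-transpose u₁ u₂ a b = all-cong (allFin 3) λ B → ≡ᵇ-comm (blockSize (col D) n a b B) (blockSize (row D) n u₁ u₂ B)

  weight-transpose : ∀ {u₁ u₂ a b} → T (balanced D n a b u₁ u₂) → weight (transpose D) n u₁ u₂ ≡ weight D n a b
  weight-transpose {u₁} {u₂} {a} {b} bal = ∏-cong (allFin 3) λ B →
    cong _! (≡ᵇ⇒≡ (blockSize (row D) n u₁ u₂ B) (blockSize (col D) n a b B)
                   (Equivalence.to (T-all-allFin (λ B → blockSize (row D) n u₁ u₂ B ≡ᵇ blockSize (col D) n a b B)) bal B))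

  occurrences-transpose : occurrences (transpose D) n ≡ occurrences D n
  occurrences-transpose = trans (∑<-cong n λ u₁ _ → ∑<-cong n λ u₂ _ → ∑<-cong n λ a _ → ∑<-cong n λ b _ → swap-roles u₁ u₂ a b)
                                (∑<-swap-pairs n (λ u₁ u₂ a b → 𝟙 (((a <ᵇ b) ∧ (u₁ <ᵇ u₂)) ∧ balanced D n a b u₁ u₂) * weight D n a b))
    where
    swap-roles : ∀ u₁ u₂ a b →
      𝟙 (((u₁ <ᵇ u₂) ∧ (a <ᵇ b)) ∧ balanced (transpose D) n u₁ u₂ a b) * weight (transpose D) n u₁ u₂
      ≡ 𝟙 (((a <ᵇ b) ∧ (u₁ <ᵇ u₂)) ∧ balanced D n a b u₁ u₂) * weight D n a b
    swap-roles u₁ u₂ a b rewrite balanced-transpose u₁ u₂ a b | ∧-comm (u₁ <ᵇ u₂) (a <ᵇ b) =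
      𝟙-guard (((a <ᵇ b) ∧ (u₁ <ᵇ u₂)) ∧ balanced D n a b u₁ u₂) λ h →
        weight-transpose (proj₂ (Equivalence.to (T-∧ {(a <ᵇ b) ∧ (u₁ <ᵇ u₂)}) h))

rigid-transpose : ∀ {D n} → Rigid D n → Rigid (transpose D) n
rigid-transpose {D} {n} rigid {u₁} {u₂} {a} {b} {v₁} {v₂} {c} {d} u₁<u₂ a<b v₁<v₂ c<d bal bal′ link₁ link₂ =
  let a≡c , b≡d = rigid a<b u₁<u₂ c<d v₁<v₂ (subst T (balanced-transpose D n u₁ u₂ a b) bal) (subst T (balanced-transpose D n v₁ v₂ c d) bal′)
                        (⇔.sym link₁) (⇔.sym link₂)
  in Equivalence.from link₁ a≡c , Equivalence.from link₂ b≡d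

module _ {n : ℕ} where

  reflect-<n : ∀ {x} → x < n → n ∸ suc x < n
  reflect-<n {x} (s≤s x≤m) = s≤s (m∸n≤m _ x)

  reflect-involutive : ∀ {x} → x < n → n ∸ suc (n ∸ suc x) ≡ x
  reflect-involutive {x} x<n = trans (cong (n ∸_) (sym (+-∸-assoc 1 x<n))) (m∸[m∸n]≡n (<⇒≤ x<n))

  reflect-injective : ∀ {x y} → x < n → y < n → n ∸ suc x ≡ n ∸ suc y → x ≡ y
  reflect-injective x<n y<n eq = suc-injective (∸-cancelˡ-≡ x<n y<n eq)

  reflect-< : ∀ {x y} → x < y → y < n → n ∸ suc y < n ∸ suc x
  reflect-< x<y y<n = ∸-monoʳ-< (s<s x<y) y<n

  reflect-<ᵇ : ∀ {x y} → x < n → y < n → (n ∸ suc y <ᵇ n ∸ suc x) ≡ (x <ᵇ y)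
  reflect-<ᵇ {x} {y} x<n y<n = T-ext (mk⇔ to (λ x<ᵇy → <⇒<ᵇ (reflect-< (<ᵇ⇒< x y x<ᵇy) y<n)))
    where
    to : T (n ∸ suc y <ᵇ n ∸ suc x) → T (x <ᵇ y)
    to h with <-cmp x y
    ... | tri< x<y _ _ = <⇒<ᵇ x<y
    ... | tri≈ _ refl _ = contradiction (<ᵇ⇒< (n ∸ suc x) (n ∸ suc x) h) (<-irrefl refl)
    ... | tri> _ _ y<x = contradiction (<ᵇ⇒< (n ∸ suc y) (n ∸ suc x) h) (<⇒≯ (reflect-< y<x x<n))

  widths-reflect : ∀ {p q} → p < q → q < n → ∀ c → width n (n ∸ suc q) (n ∸ suc p) c ≡ width n p q (opposite c)
  widths-reflect p<q q<n fzero               = refl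
  widths-reflect p<q q<n (fsuc (fsuc fzero)) = reflect-involutive (<-trans p<q q<n)
  widths-reflect {p} p<q q<n (fsuc fzero) with m≤n⇒∃[o]m+o≡n p<q
  ... | x , refl with m≤n⇒∃[o]m+o≡n q<n
  ...   | y , refl = begin
    suc (suc (p + x) + y) ∸ suc p ∸ suc (suc (suc (p + x) + y) ∸ suc (suc (p + x)))
      ≡⟨ cong₂ (λ l r → l ∸ suc r) (trans (cong (_∸ p) (trans (cong suc (+-assoc p x y)) (sym (+-suc p (x + y))))) (m+n∸m≡n p (suc (x + y))))
                                   (m+n∸m≡n (suc (p + x)) y) ⟩
    suc (x + y) ∸ suc y ≡⟨ m+n∸n≡m x y ⟩
    x                   ≡⟨ m+n∸m≡n p x ⟨
    suc (p + x) ∸ suc p ∎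
    where open ≡-Reasoning

  blockSize-rotate : ∀ g {p q} → p < q → q < n → ∀ B → blockSize (g ∘ opposite) n p q B ≡ blockSize g n (n ∸ suc q) (n ∸ suc p) B
  blockSize-rotate g {p} {q} p<q q<n B = sym (trans (∑-cong (allFin 3) λ c → cong (𝟙 (g c ≡ᶠ B) *_) (widths-reflect p<q q<n c))
                                                    (reverse₃ (term fzero) (term (fsuc fzero)) (term (fsuc (fsuc fzero)))))
    where
    term : Fin 3 → ℕ
    term c = 𝟙 (g c ≡ᶠ B) * width n p q (opposite c)
    reverse₃ : ∀ x y z → x + (y + (z + 0)) ≡ z + (y + (x + 0))
    reverse₃ = solve-∀

  ∑<-reflect-pair : ∀ (F : ℕ → ℕ → ℕ) → ∑[ x < n ] ∑[ y < n ] F x y ≡ ∑[ x < n ] ∑[ y < n ] F (n ∸ suc y) (n ∸ suc x)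
  ∑<-reflect-pair F = begin
    ∑[ x < n ] ∑[ y < n ] F x y                                 ≡⟨ ∑<-cong n (λ x _ → ∑<-reflect n (F x)) ⟩
    ∑[ x < n ] ∑[ y < n ] F x (n ∸ suc y)                       ≡⟨ ∑<-reflect n (λ x → ∑[ y < n ] F x (n ∸ suc y)) ⟩
    ∑[ x < n ] ∑[ y < n ] F (n ∸ suc x) (n ∸ suc y)             ≡⟨ ∑<-comm n n _ ⟩
    ∑[ y < n ] ∑[ x < n ] F (n ∸ suc x) (n ∸ suc y)             ∎
    where open ≡-Reasoning

module _ (D : Blocks) {n : ℕ} where

  private
    ⟨_⟩ : ℕ → ℕ
    ⟨ x ⟩ = n ∸ suc x

  balanced-rotate : ∀ {u₁ u₂ a b} → Increasing n u₁ u₂ → Increasing n a b →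
                    balanced (rotate D) n u₁ u₂ a b ≡ balanced D n ⟨ u₂ ⟩ ⟨ u₁ ⟩ ⟨ b ⟩ ⟨ a ⟩
  balanced-rotate (u₁<u₂ , u₂<n) (a<b , b<n) = all-cong (allFin 3) λ B →
    cong₂ _≡ᵇ_ (blockSize-rotate (row D) a<b b<n B) (blockSize-rotate (col D) u₁<u₂ u₂<n B)

  weight-rotate : ∀ {u₁ u₂} → Increasing n u₁ u₂ → weight (rotate D) n u₁ u₂ ≡ weight D n ⟨ u₂ ⟩ ⟨ u₁ ⟩
  weight-rotate (u₁<u₂ , u₂<n) = ∏-cong (allFin 3) λ B → cong _! (blockSize-rotate (col D) u₁<u₂ u₂<n B)

  occurrences-rotate : occurrences (rotate D) n ≡ occurrences D n
  occurrences-rotate = sym (begin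
    occurrences D n
      ≡⟨ ∑<-reflect-pair {n} (λ u₁ u₂ → ∑[ a < n ] ∑[ b < n ] Φ u₁ u₂ a b) ⟩
    ∑[ u₁ < n ] ∑[ u₂ < n ] ∑[ a < n ] ∑[ b < n ] Φ ⟨ u₂ ⟩ ⟨ u₁ ⟩ a b
      ≡⟨ ∑<-cong n (λ u₁ _ → ∑<-cong n λ u₂ _ → ∑<-reflect-pair {n} (Φ ⟨ u₂ ⟩ ⟨ u₁ ⟩)) ⟩
    ∑[ u₁ < n ] ∑[ u₂ < n ] ∑[ a < n ] ∑[ b < n ] Φ ⟨ u₂ ⟩ ⟨ u₁ ⟩ ⟨ b ⟩ ⟨ a ⟩
      ≡⟨ ∑<-cong n (λ u₁ u₁<n → ∑<-cong n λ u₂ u₂<n → ∑<-cong n λ a a<n → ∑<-cong n λ b b<n → reflected u₁<n u₂<n a<n b<n) ⟩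
    occurrences (rotate D) n ∎)
    where
    open ≡-Reasoning
    Φ : ℕ → ℕ → ℕ → ℕ → ℕ
    Φ u₁ u₂ a b = 𝟙 (((u₁ <ᵇ u₂) ∧ (a <ᵇ b)) ∧ balanced D n u₁ u₂ a b) * weight D n u₁ u₂
    reflected : ∀ {u₁ u₂ a b} → u₁ < n → u₂ < n → a < n → b < n →
      Φ ⟨ u₂ ⟩ ⟨ u₁ ⟩ ⟨ b ⟩ ⟨ a ⟩ ≡ 𝟙 (((u₁ <ᵇ u₂) ∧ (a <ᵇ b)) ∧ balanced (rotate D) n u₁ u₂ a b) * weight (rotate D) n u₁ u₂
    reflected {u₁} {u₂} {a} {b} u₁<n u₂<n a<n b<n rewrite reflect-<ᵇ u₁<n u₂<n | reflect-<ᵇ a<n b<n =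
      𝟙-∧-cong ((u₁ <ᵇ u₂) ∧ (a <ᵇ b)) (λ c → sym (balanced-rotate (u₁<u₂ c , u₂<n) (a<b c , b<n)))
                                          (λ c → sym (weight-rotate (u₁<u₂ c , u₂<n)))
      where
      u₁<u₂ = λ c → <ᵇ⇒< u₁ u₂ (proj₁ (Equivalence.to (T-∧ {u₁ <ᵇ u₂}) c))
      a<b   = λ c → <ᵇ⇒< a b (proj₂ (Equivalence.to (T-∧ {u₁ <ᵇ u₂}) c))

  rigid-rotate : Rigid D n → Rigid (rotate D) n
  rigid-rotate rigid u₁<u₂ a<b v₁<v₂ c<d bal bal′ link₁ link₂ =
    let u₂≡v₂ , u₁≡v₁ = rigid (flip u₁<u₂) (flip a<b) (flip v₁<v₂) (flip c<d)
                              (subst T (balanced-rotate u₁<u₂ a<b) bal) (subst T (balanced-rotate v₁<v₂ c<d) bal′)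
                              (reflect-link (proj₂ u₁<u₂) (proj₂ v₁<v₂) (proj₂ a<b) (proj₂ c<d) link₂)
                              (reflect-link (lower u₁<u₂) (lower v₁<v₂) (lower a<b) (lower c<d) link₁)
    in reflect-injective (lower u₁<u₂) (lower v₁<v₂) u₁≡v₁ , reflect-injective (proj₂ u₁<u₂) (proj₂ v₁<v₂) u₂≡v₂
    where
    lower : ∀ {x y} → Increasing n x y → x < n
    lower (x<y , y<n) = <-trans x<y y<n
    flip : ∀ {x y} → Increasing n x y → Increasing n ⟨ y ⟩ ⟨ x ⟩
    flip (x<y , y<n) = reflect-< x<y y<n , reflect-<n (<-trans x<y y<n)
    reflect-link : ∀ {x y z w} → x < n → y < n → z < n → w < n → (x ≡ y ⇔ z ≡ w) → (⟨ x ⟩ ≡ ⟨ y ⟩ ⇔ ⟨ z ⟩ ≡ ⟨ w ⟩)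
    reflect-link x<n y<n z<n w<n link =
      ⇔.trans (mk⇔ (reflect-injective x<n y<n) (cong ⟨_⟩)) (⇔.trans link (mk⇔ (cong ⟨_⟩) (reflect-injective z<n w<n)))

-- Patterns whose occurrences end at the maximal value

T-balanced : ∀ D n u₁ u₂ a b → T (balanced D n u₁ u₂ a b) ⇔ (∀ B → blockSize (row D) n a b B ≡ blockSize (col D) n u₁ u₂ B)
T-balanced D n u₁ u₂ a b = ⇔.trans (T-all-allFin _) (mk⇔ (λ h B → ≡ᵇ⇒≡ _ _ (h B)) (λ h B → ≡⇒≡ᵇ _ _ (h B)))

module PinnedByRightEnd (D : Blocks) (α w : ℕ → ℕ → ℕ)
  (pinned : ∀ {n u₁ u₂ a b} → Increasing n u₁ u₂ → Increasing n a b → T (balanced D n u₁ u₂ a b) ⇔ (a ≡ α n u₂ × b ≡ n ∸ 1))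
  (α-valid : ∀ {n u₁ u₂} → Increasing n u₁ u₂ → α n u₂ < n ∸ 1)
  (weight≡ : ∀ {n u₁ u₂} → Increasing n u₁ u₂ → weight D n u₁ u₂ ≡ w n u₂) where

  rigid : ∀ {n} → Rigid D n
  rigid u₁<u₂ a<b v₁<v₂ c<d bal bal′ link₁ link₂ with Equivalence.to (pinned u₁<u₂ a<b) bal | Equivalence.to (pinned v₁<v₂ c<d) bal′
  ... | a≡α , b≡n-1 | c≡α , d≡n-1 = Equivalence.from link₁ (trans a≡α (trans (cong (α _) u₂≡v₂) (sym c≡α))) , u₂≡v₂
    where u₂≡v₂ = Equivalence.from link₂ (trans b≡n-1 (sym d≡n-1))

  module _ {n u₁ u₂ : ℕ} (increasing : Increasing n u₁ u₂) where

    ordered-balanced⇔pinned : ∀ {a b} → a < n → b < n →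
                              T ((a <ᵇ b) ∧ balanced D n u₁ u₂ a b) ⇔ T ((a ≡ᵇ α n u₂) ∧ (b ≡ᵇ n ∸ 1))
    ordered-balanced⇔pinned {a} {b} a<n b<n = mk⇔
      (λ h → let a<ᵇb , bal = Equivalence.to (T-∧ {a <ᵇ b}) h
                 a≡α , b≡n-1 = Equivalence.to (pinned increasing (<ᵇ⇒< a b a<ᵇb , b<n)) bal
             in Equivalence.from T-∧ (≡⇒≡ᵇ a _ a≡α , ≡⇒≡ᵇ b _ b≡n-1))
      (λ h → let a≡ᵇα , b≡ᵇn-1 = Equivalence.to (T-∧ {a ≡ᵇ α n u₂}) h
                 a≡α = ≡ᵇ⇒≡ a _ a≡ᵇα
                 b≡n-1 = ≡ᵇ⇒≡ b _ b≡ᵇn-1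
                 a<b = subst₂ _<_ (sym a≡α) (sym b≡n-1) (α-valid increasing)
             in Equivalence.from T-∧ (<⇒<ᵇ a<b , Equivalence.from (pinned increasing (a<b , b<n)) (a≡α , b≡n-1)))

    ∑-pinned : ∑[ a < n ] ∑[ b < n ] 𝟙 ((a <ᵇ b) ∧ balanced D n u₁ u₂ a b) * weight D n u₁ u₂ ≡ w n u₂
    ∑-pinned = begin
      ∑[ a < n ] ∑[ b < n ] 𝟙 ((a <ᵇ b) ∧ balanced D n u₁ u₂ a b) * weight D n u₁ u₂
        ≡⟨ ∑<-cong n (λ a a<n → ∑<-cong n λ b b<n →
             trans (cong (λ x → 𝟙 x * weight D n u₁ u₂) (T-ext (ordered-balanced⇔pinned a<n b<n)))
                   (trans (𝟙-guard ((a ≡ᵇ α n u₂) ∧ (b ≡ᵇ n ∸ 1)) (λ _ → weight≡ increasing))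
                          (sym (𝟙-∧-* (a ≡ᵇ α n u₂) _ (w n u₂))))) ⟩
      ∑[ a < n ] ∑[ b < n ] 𝟙 (a ≡ᵇ α n u₂) * (𝟙 (b ≡ᵇ n ∸ 1) * w n u₂)
        ≡⟨ ∑<-cong n (λ a _ → *-distribˡ-∑< n (𝟙 (a ≡ᵇ α n u₂)) _) ⟨
      ∑[ a < n ] 𝟙 (a ≡ᵇ α n u₂) * (∑[ b < n ] 𝟙 (b ≡ᵇ n ∸ 1) * w n u₂)
        ≡⟨ ∑<-point (λ _ → ∑[ b < n ] 𝟙 (b ≡ᵇ n ∸ 1) * w n u₂) (<-≤-trans (α-valid increasing) (m∸n≤m n 1)) ⟩
      ∑[ b < n ] 𝟙 (b ≡ᵇ n ∸ 1) * w n u₂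
        ≡⟨ ∑<-point (λ _ → w n u₂) (∸-monoʳ-< {n} {1} {0} z<s (<-≤-trans z<s (proj₂ increasing))) ⟩
      w n u₂ ∎
      where open ≡-Reasoning

  occurrences≡ : ∀ n → occurrences D n ≡ ∑[ q < n ] q * w n q
  occurrences≡ n = begin
    occurrences D n                                  ≡⟨ ∑<-cong n (λ u₁ _ → ∑<-cong n λ u₂ u₂<n → ∑-ordered u₁ u₂<n) ⟩
    ∑[ u₁ < n ] ∑[ u₂ < n ] 𝟙 (u₁ <ᵇ u₂) * w n u₂    ≡⟨ ∑<-comm n n _ ⟩
    ∑[ u₂ < n ] ∑[ u₁ < n ] 𝟙 (u₁ <ᵇ u₂) * w n u₂    ≡⟨ ∑<-cong n (λ u₂ u₂<n → count-below u₂<n) ⟩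
    ∑[ q < n ] q * w n q                             ∎
    where
    open ≡-Reasoning
    count-below : ∀ {q} → q < n → ∑[ u₁ < n ] 𝟙 (u₁ <ᵇ q) * w n q ≡ q * w n q
    count-below {q} q<n = begin
      ∑[ u₁ < n ] 𝟙 (u₁ <ᵇ q) * w n q     ≡⟨ ∑<-cong n (λ u₁ _ → *-comm (𝟙 (u₁ <ᵇ q)) (w n q)) ⟩
      ∑[ u₁ < n ] w n q * 𝟙 (u₁ <ᵇ q)     ≡⟨ *-distribˡ-∑< n (w n q) _ ⟨
      w n q * (∑[ u₁ < n ] 𝟙 (u₁ <ᵇ q))   ≡⟨ cong (w n q *_) (∑<-below (<⇒≤ q<n)) ⟩
      w n q * q                            ≡⟨ *-comm (w n q) q ⟩
      q * w n q                            ∎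
    ∑-ordered : ∀ u₁ {u₂} → u₂ < n →
      ∑[ a < n ] ∑[ b < n ] 𝟙 (((u₁ <ᵇ u₂) ∧ (a <ᵇ b)) ∧ balanced D n u₁ u₂ a b) * weight D n u₁ u₂ ≡ 𝟙 (u₁ <ᵇ u₂) * w n u₂
    ∑-ordered u₁ {u₂} u₂<n with u₁ <ᵇ u₂ in u₁<ᵇu₂
    ... | false = ∑<-zero n λ _ _ → ∑<-zero n λ _ _ → refl
    ... | true  = trans (∑-pinned (<ᵇ⇒< u₁ u₂ (Equivalence.from T-≡ u₁<ᵇu₂) , u₂<n)) (sym (+-identityʳ (w n u₂)))

∑-applyUpTo : ∀ (f : ℕ → ℕ) m (g : ℕ → ℕ) → ∑ (applyUpTo f m) g ≡ ∑[ i < m ] g (f i)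
∑-applyUpTo f zero    g = refl
∑-applyUpTo f (suc m) g = cong (g (f 0) +_) (∑-applyUpTo (f ∘ suc) m g)

∑-factorials≡A : ∀ n → ∑[ q < n ] q * ((q ∸ 1) ! * (n ∸ suc q) !) ≡ A n
∑-factorials≡A zero    = refl
∑-factorials≡A (suc m) = begin
  0 + (∑[ j < m ] suc j * (j ! * (m ∸ suc j) !))    ≡⟨ ∑<-cong m (λ j _ → *-assoc (suc j) (j !) _) ⟨
  ∑[ j < m ] suc j ! * (m ∸ suc j) !                ≡⟨ ∑<-reflect m _ ⟩
  ∑[ i < m ] suc (m ∸ suc i) ! * (m ∸ suc (m ∸ suc i)) !
    ≡⟨ ∑<-cong m (λ i i<m → trans (cong₂ (λ x y → x ! * y !) (sym (+-∸-assoc 1 i<m)) (reflect-involutive i<m)) (*-comm _ (i !))) ⟩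
  ∑[ i < m ] i ! * (m ∸ i) !                        ≡⟨ ∑<-cong m (λ i i<m → cong (λ x → i ! * (x ∸ 1) !) (+-∸-assoc 1 (<⇒≤ i<m))) ⟨
  ∑[ i < m ] i ! * (suc m ∸ i ∸ 1) !                ≡⟨ ∑-applyUpTo id m (λ i → i ! * (suc m ∸ i ∸ 1) !) ⟨
  A (suc m)                                         ∎
  where open ≡-Reasoning

m+[n∸suc-m]≡n∸1 : ∀ {u₁ u₂} → u₁ < u₂ → u₁ + (u₂ ∸ suc u₁) ≡ u₂ ∸ 1
m+[n∸suc-m]≡n∸1 {u₁} u₁<u₂ with m≤n⇒∃[o]m+o≡n u₁<u₂
... | x , refl = cong (u₁ +_) (m+n∸m≡n u₁ x)

+-identityʳ² : ∀ x → x + 0 + 0 ≡ x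
+-identityʳ² x = trans (+-identityʳ (x + 0)) (+-identityʳ x)

∀-Fin3⇔ : {f g : Fin 3 → ℕ} →
          (∀ B → f B ≡ g B) ⇔ (f fzero ≡ g fzero × f (fsuc fzero) ≡ g (fsuc fzero) × f (fsuc (fsuc fzero)) ≡ g (fsuc (fsuc fzero)))
∀-Fin3⇔ = mk⇔ (λ h → h fzero , h (fsuc fzero) , h (fsuc (fsuc fzero)))
              λ { (h₀ , h₁ , h₂) fzero → h₀ ; (h₀ , h₁ , h₂) (fsuc fzero) → h₁ ; (h₀ , h₁ , h₂) (fsuc (fsuc fzero)) → h₂ }

n∸suc-b≡0⇔b≡n∸1 : ∀ {n b} → b < n → n ∸ suc b ≡ 0 ⇔ b ≡ n ∸ 1
n∸suc-b≡0⇔b≡n∸1 {suc m} {b} (s≤s b≤m) = mk⇔ (λ m∸b≡0 → ≤-antisym b≤m (m∸n≡0⇒m≤n m∸b≡0)) λ { refl → n∸n≡0 b }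

leftMerged : Fin 3 → Fin 3
leftMerged = lookup (# 0 ∷ # 0 ∷ # 1 ∷ [])

D₀ D₄ : Blocks
D₀ = blocks leftMerged (lookup (# 1 ∷ # 0 ∷ # 2 ∷ []))
D₄ = blocks leftMerged (lookup (# 0 ∷ # 1 ∷ # 2 ∷ []))

leftMerged-size : ∀ {u₁ u₂} → u₁ < u₂ → u₁ + 0 + (u₂ ∸ suc u₁ + 0 + 0) ≡ u₂ ∸ 1
leftMerged-size {u₁} {u₂} u₁<u₂ = trans (cong₂ _+_ (+-identityʳ u₁) (+-identityʳ² (u₂ ∸ suc u₁))) (m+[n∸suc-m]≡n∸1 u₁<u₂)

weight-leftMerged : ∀ r {n u₁ u₂} → Increasing n u₁ u₂ → weight (blocks leftMerged r) n u₁ u₂ ≡ (u₂ ∸ 1) ! * (n ∸ suc u₂) !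
weight-leftMerged r {n} (u₁<u₂ , _) =
  cong₂ _*_ (cong _! (leftMerged-size u₁<u₂)) (trans (cong (λ x → x ! * 1) (+-identityʳ² (n ∸ suc _))) (*-identityʳ _))

pinned-D₀ : ∀ {n u₁ u₂ a b} → Increasing n u₁ u₂ → Increasing n a b →
            T (balanced D₀ n u₁ u₂ a b) ⇔ (a ≡ n ∸ suc u₂ × b ≡ n ∸ 1)
pinned-D₀ {n} {u₁} {u₂} {a} {b} (u₁<u₂ , u₂<n) (a<b , b<n) = ⇔.trans (T-balanced D₀ n u₁ u₂ a b) (⇔.trans ∀-Fin3⇔ (mk⇔ to from))
  where
  to : (b ∸ suc a + 0 + 0 ≡ u₁ + 0 + (u₂ ∸ suc u₁ + 0 + 0)) × (a + 0 + 0 ≡ n ∸ suc u₂ + 0 + 0) × (n ∸ suc b + 0 + 0 ≡ 0) →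
       a ≡ n ∸ suc u₂ × b ≡ n ∸ 1
  to (_ , a≡ , top) = trans (sym (+-identityʳ² a)) (trans a≡ (+-identityʳ² _)) ,
                      Equivalence.to (n∸suc-b≡0⇔b≡n∸1 b<n) (trans (sym (+-identityʳ² _)) top)
  from : a ≡ n ∸ suc u₂ × b ≡ n ∸ 1 →
         (b ∸ suc a + 0 + 0 ≡ u₁ + 0 + (u₂ ∸ suc u₁ + 0 + 0)) × (a + 0 + 0 ≡ n ∸ suc u₂ + 0 + 0) × (n ∸ suc b + 0 + 0 ≡ 0)
  from (refl , refl) = trans (+-identityʳ² _) (trans (gap u₂<n) (sym (leftMerged-size u₁<u₂))) , refl ,
                       trans (+-identityʳ² _) (Equivalence.from (n∸suc-b≡0⇔b≡n∸1 b<n) refl)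
    where
    gap : ∀ {n u} → u < n → n ∸ 1 ∸ suc (n ∸ suc u) ≡ u ∸ 1
    gap {suc m} {u} (s≤s u≤m) = begin
      m ∸ suc (m ∸ u)      ≡⟨ cong (m ∸_) (+-comm 1 (m ∸ u)) ⟩
      m ∸ (m ∸ u + 1)      ≡⟨ ∸-+-assoc m (m ∸ u) 1 ⟨
      m ∸ (m ∸ u) ∸ 1      ≡⟨ cong (_∸ 1) (m∸[m∸n]≡n u≤m) ⟩
      u ∸ 1                ∎
      where open ≡-Reasoning

pinned-D₄ : ∀ {n u₁ u₂ a b} → Increasing n u₁ u₂ → Increasing n a b →
            T (balanced D₄ n u₁ u₂ a b) ⇔ (a ≡ u₂ ∸ 1 × b ≡ n ∸ 1)
pinned-D₄ {n} {u₁} {u₂} {a} {b} (u₁<u₂ , u₂<n) (a<b , b<n) = ⇔.trans (T-balanced D₄ n u₁ u₂ a b) (⇔.trans ∀-Fin3⇔ (mk⇔ to from))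
  where
  to : (a + 0 + 0 ≡ u₁ + 0 + (u₂ ∸ suc u₁ + 0 + 0)) × (b ∸ suc a + 0 + 0 ≡ n ∸ suc u₂ + 0 + 0) × (n ∸ suc b + 0 + 0 ≡ 0) →
       a ≡ u₂ ∸ 1 × b ≡ n ∸ 1
  to (a≡ , _ , top) = trans (sym (+-identityʳ² a)) (trans a≡ (leftMerged-size u₁<u₂)) ,
                      Equivalence.to (n∸suc-b≡0⇔b≡n∸1 b<n) (trans (sym (+-identityʳ² _)) top)
  from : a ≡ u₂ ∸ 1 × b ≡ n ∸ 1 →
         (a + 0 + 0 ≡ u₁ + 0 + (u₂ ∸ suc u₁ + 0 + 0)) × (b ∸ suc a + 0 + 0 ≡ n ∸ suc u₂ + 0 + 0) × (n ∸ suc b + 0 + 0 ≡ 0)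
  from (refl , refl) = trans (+-identityʳ² _) (sym (leftMerged-size u₁<u₂)) , cong (λ x → x + 0 + 0) (gap u₁<u₂) ,
                       trans (+-identityʳ² _) (Equivalence.from (n∸suc-b≡0⇔b≡n∸1 b<n) refl)
    where
    gap : ∀ {u v} → v < u → n ∸ 1 ∸ suc (u ∸ 1) ≡ n ∸ suc u
    gap {suc w} _ = ∸-+-assoc n 1 (suc w)

D₀-pin< : ∀ {n u₁ u₂} → Increasing n u₁ u₂ → n ∸ suc u₂ < n ∸ 1
D₀-pin< {n} (u₁<u₂ , u₂<n) = ∸-monoʳ-< {n} (s<s (≤-<-trans z≤n u₁<u₂)) u₂<n

D₄-pin< : ∀ {n u₁ u₂} → Increasing n u₁ u₂ → u₂ ∸ 1 < n ∸ 1
D₄-pin< (u₁<u₂ , u₂<n) = ∸-monoˡ-< u₂<n (≤-<-trans z≤n u₁<u₂)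

module D₀-pinned = PinnedByRightEnd D₀ (λ n u₂ → n ∸ suc u₂) (λ n u₂ → (u₂ ∸ 1) ! * (n ∸ suc u₂) !)
  pinned-D₀ D₀-pin< (weight-leftMerged (row D₀))

module D₄-pinned = PinnedByRightEnd D₄ (λ _ u₂ → u₂ ∸ 1) (λ n u₂ → (u₂ ∸ 1) ! * (n ∸ suc u₂) !)
  pinned-D₄ D₄-pin< (weight-leftMerged (row D₄))

record Counted (D : Blocks) : Set where
  field
    count : ∀ n → occurrences D n ≡ A n
    rigid : ∀ {n} → Rigid D n

transpose-counted : ∀ {D} → Counted D → Counted (transpose D)
transpose-counted {D} c = record
  { count = λ n → trans (occurrences-transpose D n) (Counted.count c n)
  ; rigid = λ {n} → rigid-transpose {D} {n} (Counted.rigid c) }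

rotate-counted : ∀ {D} → Counted D → Counted (rotate D)
rotate-counted {D} c = record
  { count = λ n → trans (occurrences-rotate D {n}) (Counted.count c n)
  ; rigid = λ {n} → rigid-rotate D {n} (Counted.rigid c) }

D₀-counted : Counted D₀
D₀-counted = record { count = λ n → trans (D₀-pinned.occurrences≡ n) (∑-factorials≡A n) ; rigid = D₀-pinned.rigid }

D₄-counted : Counted D₄
D₄-counted = record { count = λ n → trans (D₄-pinned.occurrences≡ n) (∑-factorials≡A n) ; rigid = D₄-pinned.rigid }

patternBlocks : Fin 8 → Blocks
patternBlocks fzero                                                 = D₀
patternBlocks (fsuc fzero)                                          = rotate (transpose D₀)
patternBlocks (fsuc (fsuc fzero))                                   = transpose D₀
patternBlocks (fsuc (fsuc (fsuc fzero)))                            = rotate D₀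
patternBlocks (fsuc (fsuc (fsuc (fsuc fzero))))                     = D₄
patternBlocks (fsuc (fsuc (fsuc (fsuc (fsuc fzero)))))              = rotate (transpose D₄)
patternBlocks (fsuc (fsuc (fsuc (fsuc (fsuc (fsuc fzero))))))       = transpose D₄
patternBlocks (fsuc (fsuc (fsuc (fsuc (fsuc (fsuc (fsuc fzero))))))) = rotate D₄

patternBlocks-counted : ∀ i → Counted (patternBlocks i)
patternBlocks-counted fzero                                                 = D₀-counted
patternBlocks-counted (fsuc fzero)                                          = rotate-counted (transpose-counted D₀-counted)
patternBlocks-counted (fsuc (fsuc fzero))                                   = transpose-counted D₀-counted
patternBlocks-counted (fsuc (fsuc (fsuc fzero)))                            = rotate-counted D₀-counted
patternBlocks-counted (fsuc (fsuc (fsuc (fsuc fzero))))                     = D₄-counted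
patternBlocks-counted (fsuc (fsuc (fsuc (fsuc (fsuc fzero)))))              = rotate-counted (transpose-counted D₄-counted)
patternBlocks-counted (fsuc (fsuc (fsuc (fsuc (fsuc (fsuc fzero))))))       = transpose-counted D₄-counted
patternBlocks-counted (fsuc (fsuc (fsuc (fsuc (fsuc (fsuc (fsuc fzero))))))) = rotate-counted D₄-counted

hasBlocks-fromCheck : ∀ R D → (∀ c r → T (⌊ (c , r) ∈? R ⌋ xor ⌊ col D c F.≟ row D r ⌋)) → HasBlocks R D
hasBlocks-fromCheck R D check c r with (c , r) ∈? R | col D c F.≟ row D r | check c r
... | yes cr∈R | no  differ | _ = mk⇔ (λ cr∉R → contradiction cr∈R cr∉R) (λ same → contradiction same differ)
... | no  cr∉R | yes same   | _ = mk⇔ (λ _ → same) (λ _ → cr∉R)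

pattern-hasBlocks : ∀ i → HasBlocks (pat i) (patternBlocks i)
pattern-hasBlocks i = hasBlocks-fromCheck (pat i) (patternBlocks i) λ c r →
  Equivalence.to (T-all-allFin {3} (agrees i c)) (Equivalence.to (T-all-allFin {3} (λ c → all (agrees i c) (allFin 3)))
    (Equivalence.to (T-all-allFin {8} (λ i → all (λ c → all (agrees i c) (allFin 3)) (allFin 3))) all-cells i) c) r
  where
  agrees : Fin 8 → Fin 3 → Fin 3 → Bool
  agrees i c r = ⌊ (c , r) ∈? pat i ⌋ xor ⌊ col (patternBlocks i) c F.≟ row (patternBlocks i) r ⌋
  all-cells : T (all (λ i → all (λ c → all (agrees i c) (allFin 3)) (allFin 3)) (allFin 8))
  all-cells = tt

pattern-distribution : ∀ i n → (s n 0 (pat i) ≡ n ! ∸ A n) × (s n 1 (pat i) ≡ A n) × (∀ k → 2 ≤ k → s n k (pat i) ≡ 0)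
pattern-distribution i = distribution (pattern-hasBlocks i) (Counted.rigid counted) (Counted.count counted)
  where counted = patternBlocks-counted i

expected : ℕ → ℕ → ℕ
expected n zero          = n ! ∸ A n
expected n (suc zero)    = A n
expected n (suc (suc _)) = 0

s≡expected : ∀ i n k → s n k (pat i) ≡ expected n k
s≡expected i n zero          = proj₁ (pattern-distribution i n)
s≡expected i n (suc zero)    = proj₁ (proj₂ (pattern-distribution i n))
s≡expected i n (suc (suc k)) = proj₂ (proj₂ (pattern-distribution i n)) (suc (suc k)) (s≤s (s≤s z≤n))

-- The formulas hold for n = 0 as well.
theorem3p5 : ((i j : Fin 8) → (n k : ℕ) → s n k (pat i) ≡ s n k (pat j))
    × ((i : Fin 8) → (n : ℕ) → 1 ≤ n →
         (s n 0 (pat i) ≡ (n !) ∸ A n)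
         × (s n 1 (pat i) ≡ A n)
         × ((k : ℕ) → 2 ≤ k → s n k (pat i) ≡ 0))
theorem3p5 = (λ i j n k → trans (s≡expected i n k) (sym (s≡expected j n k))) , λ i n _ → pattern-distribution i n
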